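{- For all integers $n\geq 0$, \[ \overline{S}_9(12n+11)\equiv 0 \pmod{16}\quad\text{and}\quad \overline{S}_9(24n+23)\equiv 0 \pmod{32}. \]
   Context: $\overline{S}_9(n)$ is defined by \[ \sum_{n\geq 0}\overline{S}_9(n)q^n=\prod_{n\geq 1}\frac{(1+q^{2n-1})(1-q^{9(2n-1)})}{(1+q^{9(2n-1)})(1-q^{2n-1})}=\frac{f_2^3f_9^2f_{36}}{f_1^2f_4f_{18}^3}, \] where $f_k=\prod_{m\geq 1}(1-q^{km})$. -}

module Defs where

open import Data.Nat as ℕ using (ℕ; zero; suc; _∸_)
open import Data.Integer using (ℤ; +_; _+_; _*_; -_)
open import Data.Bool using (if_then_else_)
open import Data.List using (List; []; _∷_; foldr; map; upTo)

Series : Set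
Series = ℕ → ℤ

one : Series
one zero    = + 1
one (suc _) = + 0

_·_ : Series → Series → Series
(a · b) n = foldr _+_ (+ 0) (map (λ i → a i * b (n ∸ i)) (upTo (suc n)))

infixl 7 _·_

oneMinusQ : ℕ → Series
oneMinusQ j zero = + 1
oneMinusQ j (suc n) = if suc n ℕ.≡ᵇ j then - (+ 1) else + 0

-- the series 1/(1 - q^j) = Σ_{t ≥ 0} q^{j t}  (for j ≥ 1)
geomQ : ℕ → Series
geomQ j n with j
... | zero  = + 0
... | suc j' with n ℕ.% suc j'
...   | zero  = + 1
...   | suc _ = + 0

prodS : List Series → Series
prodS = foldr _·_ one

-- truncated f_k = ∏_{m=1}^{N} (1 - q^{k m});  exact in coefficients of degree ≤ N when k ≥ 1
fT : ℕ → ℕ → Series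
fT k N = prodS (map (λ m → oneMinusQ (k ℕ.* suc m)) (upTo N))

fInvT : ℕ → ℕ → Series
fInvT k N = prodS (map (λ m → geomQ (k ℕ.* suc m)) (upTo N))

_^S_ : Series → ℕ → Series
s ^S zero  = one
s ^S suc e = s · (s ^S e)

-- Generating function f_2^3 f_9^2 f_36 / (f_1^2 f_4 f_18^3), with all products
-- truncated at N factors (factors with index m > N only affect degrees > N).
genS9 : ℕ → Series
genS9 N = (fT 2 N ^S 3) · (fT 9 N ^S 2) · fT 36 N
        · (fInvT 1 N ^S 2) · fInvT 4 N · (fInvT 18 N ^S 3)

S9bar : ℕ → ℤ
S9bar n = genS9 n n

{-# OPTIONS --safe #-}
-- Write φ(−q^d) = 1 + 2 ∑_{k≥1} (−1)^k q^(d k²). Gauss's identity φ(−q) = f₁²/f₂, which follows from the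
-- finite q-binomial theorem specialised to a finite Jacobi triple product, turns the generating function
-- into φ(−q²) φ(−q⁹) / (φ(−q) φ(−q¹⁸)). The 3-dissection φ(−q) = φ(−q⁹) − 2q W(q³) rewrites this as
-- (1 − 2v) / (1 − 2u) with u = q W(q³)/φ(−q⁹) and v = q² W(q⁶)/φ(−q¹⁸), which modulo 32 is
-- R + 4u² − 16u³v for a polynomial R in u and v. Since 1/φ(−q^d) ≡ 1 − 2A + 4A² (mod 8) with
-- A = (φ(−q^d) − 1)/2, and squaring is additive modulo 2, u² modulo 8 and u³v modulo 2 become explicit
-- products of W's and φ's. Each series left over is supported on explicit residue classes modulo 24:
-- at n ≡ 11 (mod 12) only terms carrying a factor 16 survive, and at n ≡ 23 (mod 24) only the multiple
-- of 32 does. All identities are proved for truncations modulo q^(N+1), which form a commutative ring.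
module Submission where

open import Algebra.Bundles using (CommutativeMonoid; CommutativeRing)
open import Algebra.Structures using (IsCommutativeRing)
import Algebra.Solver.CommutativeMonoid as CommutativeMonoidSolver
import Algebra.Solver.Ring
import Algebra.Solver.Ring.AlmostCommutativeRing as ACR
open import Data.Bool as Bool using (true; false; if_then_else_)
open import Data.Empty using (⊥-elim)
open import Data.Fin using (Fin; toℕ; fromℕ<; #_)
open import Data.Fin.Properties using (all?; toℕ-fromℕ<)
open import Data.Integer as ℤ using (ℤ; +_; -1ℤ)
import Data.Integer.Properties as ℤ
open import Data.Integer.Divisibility using (_∣_)
open import Data.Integer.Divisibility.Signed as Signed using (∣⇒∣ᵤ)
open import Data.Integer.Tactic.RingSolver using (solve-∀)
open import Data.List using (List; []; _∷_; upTo; applyUpTo; foldr; map; cartesianProductWith)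
open import Data.List.Properties using (map-applyUpTo)
open import Data.List.Membership.Propositional.Properties using (∈-cartesianProductWith⁺)
open import Data.List.Relation.Unary.Any using (here)
open import Data.Maybe using (Maybe; just; nothing)
open import Data.Nat as ℕ using (ℕ; zero; suc; _∸_; _≤_; _<_; z≤n; s≤s)
open import Data.Nat.DivMod using (m<n⇒m%n≡m; [m+n]%n≡m%n; m≡m%n+[m/n]*n; [m+kn]%n≡m%n; m%n<n; %-distribˡ-+)
import Data.Nat.Properties as ℕ
import Data.Nat.Tactic.RingSolver as ℕ-Solver
open import Data.List.Membership.DecPropositional ℕ._≟_ using (_∈_; _∉_; _∈?_; _∉?_)
open import Data.List.Relation.Binary.Subset.DecPropositional ℕ._≟_ using (_⊆_; _⊆?_)
open import Data.Product using (_×_; _,_; proj₁; proj₂)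
open import Data.Sum using (_⊎_; inj₁; inj₂)
open import Data.Vec using ([]; _∷_)
open import Function using (_∘_)
open import Level using (_⊔_; 0ℓ)
open import Relation.Binary.PropositionalEquality as ≡ using (_≡_; _≗_)
import Relation.Binary.Reasoning.Setoid as SetoidReasoning
open import Relation.Nullary using (yes; no)
open import Relation.Nullary.Decidable using (True; toWitness)
open import Relation.Unary using (Decidable)

open import Defs

-- Finite sums and products

bigop : ∀ {a} {A : Set a} → (A → A → A) → A → ℕ → (ℕ → A) → A
bigop _∙_ ε zero    f = ε
bigop _∙_ ε (suc K) f = f 0 ∙ bigop _∙_ ε K (f ∘ suc)

module BigOperator {c ℓ} (M : CommutativeMonoid c ℓ) where
  open CommutativeMonoid M
  open SetoidReasoning setoid

  big : ℕ → (ℕ → Carrier) → Carrier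
  big = bigop _∙_ ε

  big-cong : ∀ K {f g} → (∀ k → k < K → f k ≈ g k) → big K f ≈ big K g
  big-cong zero    f≈g = refl
  big-cong (suc K) f≈g = ∙-cong (f≈g 0 (s≤s z≤n)) (big-cong K (λ k k<K → f≈g (suc k) (s≤s k<K)))

  big-split : ∀ K L f → big (K ℕ.+ L) f ≈ big K f ∙ big L (λ k → f (K ℕ.+ k))
  big-split zero    L f = sym (identityˡ _)
  big-split (suc K) L f = begin
    f 0 ∙ big (K ℕ.+ L) (f ∘ suc)                          ≈⟨ ∙-congˡ (big-split K L (f ∘ suc)) ⟩
    f 0 ∙ (big K (f ∘ suc) ∙ big L (λ k → f (suc K ℕ.+ k))) ≈⟨ assoc _ _ _ ⟨
    f 0 ∙ big K (f ∘ suc) ∙ big L (λ k → f (suc K ℕ.+ k))   ∎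

  big-snoc : ∀ K f → big (suc K) f ≈ big K f ∙ f K
  big-snoc K f = begin
    big (suc K) f             ≡⟨ ≡.cong (λ L → big L f) (ℕ.+-comm 1 K) ⟩
    big (K ℕ.+ 1) f             ≈⟨ big-split K 1 f ⟩
    big K f ∙ (f (K ℕ.+ 0) ∙ ε) ≈⟨ ∙-congˡ (identityʳ _) ⟩
    big K f ∙ f (K ℕ.+ 0)       ≡⟨ ≡.cong (λ k → big K f ∙ f k) (ℕ.+-identityʳ K) ⟩
    big K f ∙ f K             ∎

  big-merge : ∀ K f g → big K (λ k → f k ∙ g k) ≈ big K f ∙ big K g
  big-merge zero    f g = sym (identityˡ ε)
  big-merge (suc K) f g = begin
    (f 0 ∙ g 0) ∙ big K (λ k → f (suc k) ∙ g (suc k))     ≈⟨ ∙-congˡ (big-merge K (f ∘ suc) (g ∘ suc)) ⟩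
    (f 0 ∙ g 0) ∙ (big K (f ∘ suc) ∙ big K (g ∘ suc))     ≈⟨ interchange _ _ _ _ ⟩
    (f 0 ∙ big K (f ∘ suc)) ∙ (g 0 ∙ big K (g ∘ suc))     ∎
    where open import Algebra.Properties.CommutativeSemigroup commutativeSemigroup using (interchange)

  big-reverse : ∀ K f → big K f ≈ big K (λ k → f (K ∸ suc k))
  big-reverse zero    f = refl
  big-reverse (suc K) f = begin
    big (suc K) f                            ≈⟨ big-snoc K f ⟩
    big K f ∙ f K                            ≈⟨ ∙-congʳ (big-reverse K f) ⟩
    big K (λ k → f (K ∸ suc k)) ∙ f K        ≈⟨ comm _ _ ⟩
    f K ∙ big K (λ k → f (K ∸ suc k))        ∎

  big-ε : ∀ K {f} → (∀ k → k < K → f k ≈ ε) → big K f ≈ ε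
  big-ε K {f} f≈ε = trans (big-cong K f≈ε) (big-const-ε K)
    where
    big-const-ε : ∀ K → big K (λ _ → ε) ≈ ε
    big-const-ε zero    = refl
    big-const-ε (suc K) = trans (identityˡ _) (big-const-ε K)

  big-extend : ∀ {K L} f → K ≤ L → (∀ k → K ≤ k → f k ≈ ε) → big L f ≈ big K f
  big-extend {K} {L} f K≤L tail≈ε = begin
    big L f                                    ≡⟨ ≡.cong (λ L → big L f) (ℕ.m+[n∸m]≡n K≤L) ⟨
    big (K ℕ.+ (L ∸ K)) f                        ≈⟨ big-split K (L ∸ K) f ⟩
    big K f ∙ big (L ∸ K) (λ k → f (K ℕ.+ k))    ≈⟨ ∙-congˡ (big-ε (L ∸ K) (λ k _ → tail≈ε (K ℕ.+ k) (ℕ.m≤m+n K k))) ⟩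
    big K f ∙ ε                                ≈⟨ identityʳ _ ⟩
    big K f                                    ∎

  big-blocks : ∀ K m f → big (K ℕ.* m) f ≈ big K (λ i → big m (λ j → f (i ℕ.* m ℕ.+ j)))
  big-blocks zero    m f = refl
  big-blocks (suc K) m f = begin
    big (m ℕ.+ K ℕ.* m) f                                               ≈⟨ big-split m (K ℕ.* m) f ⟩
    big m f ∙ big (K ℕ.* m) (λ k → f (m ℕ.+ k))                         ≈⟨ ∙-congˡ (big-blocks K m (λ k → f (m ℕ.+ k))) ⟩
    big m f ∙ big K (λ i → big m (λ j → f (m ℕ.+ (i ℕ.* m ℕ.+ j))))       ≈⟨ ∙-congˡ (big-cong K (λ i _ → big-cong m (λ j _ →
                                                                         reflexive (≡.cong f (ℕ.+-assoc m (i ℕ.* m) j))))) ⟨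
    big m f ∙ big K (λ i → big m (λ j → f (suc i ℕ.* m ℕ.+ j)))         ∎

module FiniteSums {c ℓ} (R : CommutativeRing c ℓ) where
  open CommutativeRing R

  open BigOperator +-commutativeMonoid public
    using ()
    renaming (big to ∑; big-cong to ∑-cong; big-split to ∑-split; big-snoc to ∑-snoc; big-merge to ∑-merge;
              big-reverse to ∑-reverse; big-extend to ∑-extend; big-blocks to ∑-blocks)
  open BigOperator *-commutativeMonoid public
    using ()
    renaming (big to ∏; big-cong to ∏-cong; big-split to ∏-split; big-snoc to ∏-snoc; big-merge to ∏-merge;
              big-reverse to ∏-reverse; big-ε to ∏-one; big-extend to ∏-extend; big-blocks to ∏-blocks)

  ∑-distribˡ : ∀ K x f → x * ∑ K f ≈ ∑ K (λ k → x * f k)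
  ∑-distribˡ zero    x f = zeroʳ x
  ∑-distribˡ (suc K) x f = trans (distribˡ x (f 0) _) (+-congˡ (∑-distribˡ K x (f ∘ suc)))

  ∑-distribʳ : ∀ K x f → ∑ K f * x ≈ ∑ K (λ k → f k * x)
  ∑-distribʳ zero    x f = zeroˡ x
  ∑-distribʳ (suc K) x f = trans (distribʳ x (f 0) _) (+-congˡ (∑-distribʳ K x (f ∘ suc)))

  ∑-neg : ∀ K f → - ∑ K f ≈ ∑ K (λ k → - f k)
  ∑-neg zero    f = -0#≈0#
    where open import Algebra.Properties.Ring ring using (-0#≈0#)
  ∑-neg (suc K) f = trans (sym (-‿+-comm (f 0) _)) (+-congˡ (∑-neg K (f ∘ suc)))
    where open import Algebra.Properties.Ring ring using (-‿+-comm)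

-- Congruences modulo a principal ideal

module Congruence {c ℓ} (R : CommutativeRing c ℓ) where
  open CommutativeRing R

  open import Algebra.Properties.Ring ring using (-‿+-comm; -‿distribʳ-*)

  open FiniteSums R using (∑)
  open import Algebra.Solver.Ring.NaturalCoefficients.Default commutativeSemiring using (solve; _:+_; _:*_; _:=_)

  infix 4 _≡_[mod_]
  record _≡_[mod_] (x y m : Carrier) : Set (c ⊔ ℓ) where
    constructor _,_
    field
      quotient : Carrier
      x≈y+mq   : x ≈ y + m * quotient
  open _≡_[mod_] public

  module _ {m : Carrier} where
    open SetoidReasoning setoid

    ≈⇒≡mod : ∀ {x y} → x ≈ y → x ≡ y [mod m ]
    ≈⇒≡mod {x} {y} x≈y = 0# , trans x≈y (sym (trans (+-congˡ (zeroʳ m)) (+-identityʳ y)))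

    mod-sym : ∀ {x y} → x ≡ y [mod m ] → y ≡ x [mod m ]
    mod-sym {x} {y} (k , x≈) = - k , (begin
      y                         ≈⟨ +-identityʳ y ⟨
      y + 0#                    ≈⟨ +-congˡ (trans (*-congˡ (-‿inverseʳ k)) (zeroʳ m)) ⟨
      y + m * (k - k)           ≈⟨ +-congˡ (distribˡ m k (- k)) ⟩
      y + (m * k + m * (- k))   ≈⟨ +-assoc y (m * k) (m * (- k)) ⟨
      (y + m * k) + m * (- k)   ≈⟨ +-congʳ x≈ ⟨
      x + m * (- k)             ∎)

    mod-trans : ∀ {x y z} → x ≡ y [mod m ] → y ≡ z [mod m ] → x ≡ z [mod m ]
    mod-trans {x} {y} {z} (k , x≈) (l , y≈) = l + k , (begin
      x                         ≈⟨ x≈ ⟩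
      y + m * k                 ≈⟨ +-congʳ y≈ ⟩
      (z + m * l) + m * k       ≈⟨ solve 4 (λ z m l k → (z :+ m :* l) :+ m :* k := z :+ m :* (l :+ k)) refl z m l k ⟩
      z + m * (l + k)           ∎)

    mod-+-cong : ∀ {x x′ y y′} → x ≡ x′ [mod m ] → y ≡ y′ [mod m ] → x + y ≡ x′ + y′ [mod m ]
    mod-+-cong {x} {x′} {y} {y′} (k , x≈) (l , y≈) = k + l , (begin
      x + y                           ≈⟨ +-cong x≈ y≈ ⟩
      (x′ + m * k) + (y′ + m * l)     ≈⟨ solve 5 (λ x y m k l → (x :+ m :* k) :+ (y :+ m :* l) := (x :+ y) :+ m :* (k :+ l)) refl x′ y′ m k l ⟩
      (x′ + y′) + m * (k + l)         ∎)

    mod-*-cong : ∀ {x x′ y y′} → x ≡ x′ [mod m ] → y ≡ y′ [mod m ] → x * y ≡ x′ * y′ [mod m ]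
    mod-*-cong {x} {x′} {y} {y′} (k , x≈) (l , y≈) = k * y′ + x′ * l + m * k * l , (begin
      x * y                                          ≈⟨ *-cong x≈ y≈ ⟩
      (x′ + m * k) * (y′ + m * l)                    ≈⟨ solve 5 (λ x y m k l → (x :+ m :* k) :* (y :+ m :* l)
                                                          := x :* y :+ m :* (k :* y :+ x :* l :+ m :* k :* l)) refl x′ y′ m k l ⟩
      x′ * y′ + m * (k * y′ + x′ * l + m * k * l)    ∎)

    mod-+-congˡ : ∀ x {y y′} → y ≡ y′ [mod m ] → x + y ≡ x + y′ [mod m ]
    mod-+-congˡ x = mod-+-cong (≈⇒≡mod refl)

    mod-*-congˡ : ∀ x {y y′} → y ≡ y′ [mod m ] → x * y ≡ x * y′ [mod m ]
    mod-*-congˡ x = mod-*-cong (≈⇒≡mod refl)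

    mod-*-congʳ : ∀ x {y y′} → y ≡ y′ [mod m ] → y * x ≡ y′ * x [mod m ]
    mod-*-congʳ x y≡ = mod-*-cong y≡ (≈⇒≡mod refl)

    mod-neg-cong : ∀ {x x′} → x ≡ x′ [mod m ] → - x ≡ - x′ [mod m ]
    mod-neg-cong {x} {x′} (k , x≈) = - k , (begin
      - x                    ≈⟨ -‿cong x≈ ⟩
      - (x′ + m * k)         ≈⟨ -‿+-comm x′ (m * k) ⟨
      - x′ + - (m * k)       ≈⟨ +-congˡ (-‿distribʳ-* m k) ⟩
      - x′ + m * (- k)       ∎)

  isQuotientRing : ∀ m → IsCommutativeRing _≡_[mod m ] _+_ _*_ -_ 0# 1#
  isQuotientRing m = record
    { isRing = record
      { +-isAbelianGroup = record
        { isGroup = record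
          { isMonoid = record
            { isSemigroup = record
              { isMagma = record
                { isEquivalence = record { refl = ≈⇒≡mod refl ; sym = mod-sym ; trans = mod-trans }
                ; ∙-cong = mod-+-cong }
              ; assoc = λ x y z → ≈⇒≡mod (+-assoc x y z) }
            ; identity = (λ x → ≈⇒≡mod (+-identityˡ x)) , (λ x → ≈⇒≡mod (+-identityʳ x)) }
          ; inverse = (λ x → ≈⇒≡mod (-‿inverseˡ x)) , (λ x → ≈⇒≡mod (-‿inverseʳ x))
          ; ⁻¹-cong = mod-neg-cong }
        ; comm = λ x y → ≈⇒≡mod (+-comm x y) }
      ; *-cong = mod-*-cong
      ; *-assoc = λ x y z → ≈⇒≡mod (*-assoc x y z)
      ; *-identity = (λ x → ≈⇒≡mod (*-identityˡ x)) , (λ x → ≈⇒≡mod (*-identityʳ x))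
      ; distrib = (λ x y z → ≈⇒≡mod (distribˡ x y z)) , (λ x y z → ≈⇒≡mod (distribʳ x y z)) }
    ; *-comm = λ x y → ≈⇒≡mod (*-comm x y) }

  quotientRing : Carrier → CommutativeRing c (c ⊔ ℓ)
  quotientRing m = record { isCommutativeRing = isQuotientRing m }

  mod-∑-cong : ∀ {m} K {f g} → (∀ k → k < K → f k ≡ g k [mod m ]) → ∑ K f ≡ ∑ K g [mod m ]
  mod-∑-cong {m} = FiniteSums.∑-cong (quotientRing m)

  mod-cong-modulus : ∀ {x y m m′} → m ≈ m′ → x ≡ y [mod m ] → x ≡ y [mod m′ ]
  mod-cong-modulus m≈m′ (k , x≈) = k , trans x≈ (+-congˡ (*-congʳ m≈m′))

  mod-scale : ∀ {x y} a m → x ≡ y [mod m ] → a * x ≡ a * y [mod a * m ]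
  mod-scale {x} {y} a m (k , x≈) = k , trans (*-congˡ x≈)
    (solve 4 (λ a y m k → a :* (y :+ m :* k) := a :* y :+ (a :* m) :* k) refl a y m k)

  module _ {m} (m≈2 : m ≈ 1# + 1#) where

    x+x≡0[mod2] : ∀ x → x + x ≡ 0# [mod m ]
    x+x≡0[mod2] x = x , (begin
      x + x                   ≈⟨ +-cong (*-identityˡ x) (*-identityˡ x) ⟨
      1# * x + 1# * x         ≈⟨ distribʳ x 1# 1# ⟨
      (1# + 1#) * x           ≈⟨ *-congʳ m≈2 ⟨
      m * x                   ≈⟨ +-identityˡ _ ⟨
      0# + m * x              ∎)
      where open SetoidReasoning setoid

    square-∑≡∑-square : ∀ K f → ∑ K f * ∑ K f ≡ ∑ K (λ k → f k * f k) [mod m ]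
    square-∑≡∑-square zero    f = ≈⇒≡mod (zeroˡ 0#)
    square-∑≡∑-square (suc K) f = begin
      (a + S) * (a + S)
        ≈⟨ ≈⇒≡mod (solve 2 (λ a S → (a :+ S) :* (a :+ S) := (a :* a :+ S :* S) :+ (a :* S :+ a :* S)) refl a S) ⟩
      (a * a + S * S) + (a * S + a * S)                   ≈⟨ mod-+-cong (mod-+-cong (≈⇒≡mod refl) (square-∑≡∑-square K (f ∘ suc))) (x+x≡0[mod2] (a * S)) ⟩
      (a * a + ∑ K (λ k → f (suc k) * f (suc k))) + 0#    ≈⟨ ≈⇒≡mod (+-identityʳ _) ⟩
      a * a + ∑ K (λ k → f (suc k) * f (suc k))           ∎
      where
      open SetoidReasoning (CommutativeRing.setoid (quotientRing m))
      a = f 0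
      S = ∑ K (f ∘ suc)

-- Opened only here: in the generic modules above they would clash with the ring operations.
open import Data.Nat using (_+_; _*_; _%_; _/_; _≡ᵇ_)
open ≡ using (refl; cong; cong₂; sym; trans)

-- Power series

infixl 6 _⊕_
infix  8 ⊝_

_⊕_ : Series → Series → Series
(a ⊕ b) n = a n ℤ.+ b n

⊝_ : Series → Series
(⊝ a) n = ℤ.- a n

cst : ℤ → Series
cst k zero    = k
cst k (suc _) = + 0

0ₛ 1ₛ : Series
0ₛ = cst (+ 0)
1ₛ = cst (+ 1)

0ₛ-coeff : ∀ n → 0ₛ n ≡ + 0
0ₛ-coeff zero    = refl
0ₛ-coeff (suc _) = refl

q^_ : ℕ → Series
(q^ e) n = if n ≡ᵇ e then + 1 else + 0

tail : Series → Series
tail a n = a (suc n)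

·-coeff-zero : ∀ a b → (a · b) 0 ≡ a 0 ℤ.* b 0
·-coeff-zero a b = ℤ.+-identityʳ _

·-coeff-suc : ∀ a b n → (a · b) (suc n) ≡ a 0 ℤ.* b (suc n) ℤ.+ (tail a · b) n
·-coeff-suc a b n = cong (ℤ._+_ (a 0 ℤ.* b (suc n))) (trans
  (cong (foldr ℤ._+_ (+ 0)) (map-applyUpTo suc (λ i → a i ℤ.* b (suc n ∸ i)) (suc n)))
  (sym (cong (foldr ℤ._+_ (+ 0)) (map-applyUpTo (λ i → i) (λ i → a (suc i) ℤ.* b (n ∸ i)) (suc n)))))

·-cong≤ : ∀ n {a a′ b b′} → (∀ i → i ≤ n → a i ≡ a′ i) → (∀ i → i ≤ n → b i ≡ b′ i) → (a · b) n ≡ (a′ · b′) n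
·-cong≤ zero {a} {a′} {b} {b′} a≡ b≡ = begin
  (a · b) 0        ≡⟨ ·-coeff-zero a b ⟩
  a 0 ℤ.* b 0      ≡⟨ cong₂ ℤ._*_ (a≡ 0 z≤n) (b≡ 0 z≤n) ⟩
  a′ 0 ℤ.* b′ 0    ≡⟨ ·-coeff-zero a′ b′ ⟨
  (a′ · b′) 0      ∎
  where open ≡.≡-Reasoning
·-cong≤ (suc n) {a} {a′} {b} {b′} a≡ b≡ = begin
  (a · b) (suc n)                                 ≡⟨ ·-coeff-suc a b n ⟩
  a 0 ℤ.* b (suc n) ℤ.+ (tail a · b) n            ≡⟨ cong₂ ℤ._+_ (cong₂ ℤ._*_ (a≡ 0 z≤n) (b≡ (suc n) ℕ.≤-refl))
                                                        (·-cong≤ n (λ i i≤n → a≡ (suc i) (s≤s i≤n)) (λ i i≤n → b≡ i (ℕ.m≤n⇒m≤1+n i≤n))) ⟩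
  a′ 0 ℤ.* b′ (suc n) ℤ.+ (tail a′ · b′) n        ≡⟨ ·-coeff-suc a′ b′ n ⟨
  (a′ · b′) (suc n)                               ∎
  where open ≡.≡-Reasoning

·-cong : ∀ {a a′ b b′} → a ≗ a′ → b ≗ b′ → a · b ≗ a′ · b′
·-cong a≗ b≗ n = ·-cong≤ n (λ i _ → a≗ i) (λ i _ → b≗ i)

cst-· : ∀ k a n → (cst k · a) n ≡ k ℤ.* a n
cst-· k a zero    = ·-coeff-zero (cst k) a
cst-· k a (suc n) = trans (·-coeff-suc (cst k) a n) (trans (cong (ℤ._+_ (k ℤ.* a (suc n))) (zero-· n)) (ℤ.+-identityʳ _))
  where
  zero-· : ∀ n → ((λ _ → + 0) · a) n ≡ + 0
  zero-· zero    = ·-coeff-zero (λ _ → + 0) a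
  zero-· (suc n) = trans (·-coeff-suc (λ _ → + 0) a n) (trans (ℤ.+-identityˡ _) (zero-· n))

·-identityˡ : ∀ a → 1ₛ · a ≗ a
·-identityˡ a n = trans (cst-· (+ 1) a n) (ℤ.*-identityˡ (a n))

·-distribʳ : ∀ a b c → (a ⊕ b) · c ≗ a · c ⊕ b · c
·-distribʳ a b c zero = begin
  ((a ⊕ b) · c) 0                     ≡⟨ ·-coeff-zero (a ⊕ b) c ⟩
  (a 0 ℤ.+ b 0) ℤ.* c 0               ≡⟨ ℤ.*-distribʳ-+ (c 0) (a 0) (b 0) ⟩
  a 0 ℤ.* c 0 ℤ.+ b 0 ℤ.* c 0         ≡⟨ cong₂ ℤ._+_ (·-coeff-zero a c) (·-coeff-zero b c) ⟨
  (a · c) 0 ℤ.+ (b · c) 0             ∎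
  where open ≡.≡-Reasoning
·-distribʳ a b c (suc n) = begin
  ((a ⊕ b) · c) (suc n)                                               ≡⟨ ·-coeff-suc (a ⊕ b) c n ⟩
  (a 0 ℤ.+ b 0) ℤ.* c (suc n) ℤ.+ ((tail a ⊕ tail b) · c) n
    ≡⟨ cong₂ ℤ._+_ (ℤ.*-distribʳ-+ (c (suc n)) (a 0) (b 0)) (·-distribʳ (tail a) (tail b) c n) ⟩
  (a 0 ℤ.* c (suc n) ℤ.+ b 0 ℤ.* c (suc n)) ℤ.+ ((tail a · c) n ℤ.+ (tail b · c) n)
                                                                      ≡⟨ shuffle (a 0 ℤ.* c (suc n)) (b 0 ℤ.* c (suc n)) _ _ ⟩
  (a 0 ℤ.* c (suc n) ℤ.+ (tail a · c) n) ℤ.+ (b 0 ℤ.* c (suc n) ℤ.+ (tail b · c) n)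
                                                                      ≡⟨ cong₂ ℤ._+_ (·-coeff-suc a c n) (·-coeff-suc b c n) ⟨
  (a · c) (suc n) ℤ.+ (b · c) (suc n)                                 ∎
  where
  open ≡.≡-Reasoning
  shuffle : ∀ x y z w → (x ℤ.+ y) ℤ.+ (z ℤ.+ w) ≡ (x ℤ.+ z) ℤ.+ (y ℤ.+ w)
  shuffle = solve-∀

·-comm : ∀ a b → a · b ≗ b · a
·-comm a b zero = begin
  (a · b) 0    ≡⟨ ·-coeff-zero a b ⟩
  a 0 ℤ.* b 0  ≡⟨ ℤ.*-comm (a 0) (b 0) ⟩
  b 0 ℤ.* a 0  ≡⟨ ·-coeff-zero b a ⟨
  (b · a) 0    ∎
  where open ≡.≡-Reasoning
·-comm a b (suc zero) = begin
  (a · b) 1                          ≡⟨ ·-coeff-suc a b 0 ⟩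
  a 0 ℤ.* b 1 ℤ.+ (tail a · b) 0     ≡⟨ cong (ℤ._+_ (a 0 ℤ.* b 1)) (·-coeff-zero (tail a) b) ⟩
  a 0 ℤ.* b 1 ℤ.+ a 1 ℤ.* b 0        ≡⟨ swap (a 0) (b 1) (a 1) (b 0) ⟩
  b 0 ℤ.* a 1 ℤ.+ b 1 ℤ.* a 0        ≡⟨ cong (ℤ._+_ (b 0 ℤ.* a 1)) (·-coeff-zero (tail b) a) ⟨
  b 0 ℤ.* a 1 ℤ.+ (tail b · a) 0     ≡⟨ ·-coeff-suc b a 0 ⟨
  (b · a) 1                          ∎
  where
  open ≡.≡-Reasoning
  swap : ∀ x y z w → x ℤ.* y ℤ.+ z ℤ.* w ≡ w ℤ.* z ℤ.+ y ℤ.* x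
  swap = solve-∀
·-comm a b (suc (suc n)) = begin
  (a · b) (2 + n)                                          ≡⟨ ·-coeff-suc a b (suc n) ⟩
  x ℤ.+ (tail a · b) (suc n)                               ≡⟨ cong (ℤ._+_ x) (·-comm (tail a) b (suc n)) ⟩
  x ℤ.+ (b · tail a) (suc n)                               ≡⟨ cong (ℤ._+_ x) (·-coeff-suc b (tail a) n) ⟩
  x ℤ.+ (y ℤ.+ (tail b · tail a) n)                        ≡⟨ cong (λ z → x ℤ.+ (y ℤ.+ z)) (·-comm (tail b) (tail a) n) ⟩
  x ℤ.+ (y ℤ.+ (tail a · tail b) n)                        ≡⟨ exchange x y _ ⟩
  y ℤ.+ (x ℤ.+ (tail a · tail b) n)                        ≡⟨ cong (ℤ._+_ y) (·-coeff-suc a (tail b) n) ⟨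
  y ℤ.+ (a · tail b) (suc n)                               ≡⟨ cong (ℤ._+_ y) (·-comm a (tail b) (suc n)) ⟩
  y ℤ.+ (tail b · a) (suc n)                               ≡⟨ ·-coeff-suc b a (suc n) ⟨
  (b · a) (2 + n)                                          ∎
  where
  open ≡.≡-Reasoning
  x = a 0 ℤ.* b (2 + n)
  y = b 0 ℤ.* a (2 + n)
  exchange : ∀ x y z → x ℤ.+ (y ℤ.+ z) ≡ y ℤ.+ (x ℤ.+ z)
  exchange = solve-∀

tail-· : ∀ a b → tail (a · b) ≗ cst (a 0) · tail b ⊕ tail a · b
tail-· a b n = trans (·-coeff-suc a b n) (cong (ℤ._+ (tail a · b) n) (sym (cst-· (a 0) (tail b) n)))

·-assoc : ∀ a b c → (a · b) · c ≗ a · (b · c)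
·-assoc a b c zero = begin
  ((a · b) · c) 0          ≡⟨ ·-coeff-zero (a · b) c ⟩
  (a · b) 0 ℤ.* c 0        ≡⟨ cong (ℤ._* c 0) (·-coeff-zero a b) ⟩
  a 0 ℤ.* b 0 ℤ.* c 0      ≡⟨ ℤ.*-assoc (a 0) (b 0) (c 0) ⟩
  a 0 ℤ.* (b 0 ℤ.* c 0)    ≡⟨ cong (a 0 ℤ.*_) (·-coeff-zero b c) ⟨
  a 0 ℤ.* (b · c) 0        ≡⟨ ·-coeff-zero a (b · c) ⟨
  (a · (b · c)) 0          ∎
  where open ≡.≡-Reasoning
·-assoc a b c (suc n) = begin
  ((a · b) · c) (suc n)                                                ≡⟨ ·-coeff-suc (a · b) c n ⟩
  (a · b) 0 ℤ.* c (suc n) ℤ.+ (tail (a · b) · c) n                     ≡⟨ cong₂ ℤ._+_ (cong (ℤ._* c (suc n)) (·-coeff-zero a b))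
                                                                            (·-cong {b = c} {b′ = c} (tail-· a b) (λ _ → refl) n) ⟩
  a 0 ℤ.* b 0 ℤ.* c (suc n) ℤ.+ ((cst (a 0) · tail b ⊕ tail a · b) · c) n
                                                                       ≡⟨ cong (ℤ._+_ (a 0 ℤ.* b 0 ℤ.* c (suc n))) (·-distribʳ (cst (a 0) · tail b) (tail a · b) c n) ⟩
  a 0 ℤ.* b 0 ℤ.* c (suc n) ℤ.+ (((cst (a 0) · tail b) · c) n ℤ.+ ((tail a · b) · c) n)
                                                                       ≡⟨ cong (ℤ._+_ (a 0 ℤ.* b 0 ℤ.* c (suc n)))
                                                                            (cong₂ ℤ._+_ (trans (·-assoc (cst (a 0)) (tail b) c n) (cst-· (a 0) (tail b · c) n))
                                                                                         (·-assoc (tail a) b c n)) ⟩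
  a 0 ℤ.* b 0 ℤ.* c (suc n) ℤ.+ (a 0 ℤ.* (tail b · c) n ℤ.+ (tail a · (b · c)) n)
                                                                       ≡⟨ factor (a 0) (b 0) (c (suc n)) ((tail b · c) n) ((tail a · (b · c)) n) ⟩
  a 0 ℤ.* (b 0 ℤ.* c (suc n) ℤ.+ (tail b · c) n) ℤ.+ (tail a · (b · c)) n
                                                                       ≡⟨ cong (λ z → a 0 ℤ.* z ℤ.+ (tail a · (b · c)) n) (·-coeff-suc b c n) ⟨
  a 0 ℤ.* (b · c) (suc n) ℤ.+ (tail a · (b · c)) n                     ≡⟨ ·-coeff-suc a (b · c) n ⟨
  (a · (b · c)) (suc n)                                                ∎
  where
  open ≡.≡-Reasoning
  factor : ∀ x y z w v → x ℤ.* y ℤ.* z ℤ.+ (x ℤ.* w ℤ.+ v) ≡ x ℤ.* (y ℤ.* z ℤ.+ w) ℤ.+ v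
  factor = solve-∀

q^suc-·-zero : ∀ e a → (q^ suc e · a) 0 ≡ + 0
q^suc-·-zero e a = ·-coeff-zero (q^ suc e) a

q^suc-·-suc : ∀ e a n → (q^ suc e · a) (suc n) ≡ (q^ e · a) n
q^suc-·-suc e a n = trans (·-coeff-suc (q^ suc e) a n) (ℤ.+-identityˡ _)

q^0≗1ₛ : q^ 0 ≗ 1ₛ
q^0≗1ₛ zero    = refl
q^0≗1ₛ (suc _) = refl

q^-·-below : ∀ e a n → n < e → (q^ e · a) n ≡ + 0
q^-·-below (suc e) a zero    _         = q^suc-·-zero e a
q^-·-below (suc e) a (suc n) (s≤s n<e) = trans (q^suc-·-suc e a n) (q^-·-below e a n n<e)

q^-·-shift : ∀ e a n → (q^ e · a) (e + n) ≡ a n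
q^-·-shift zero    a n = trans (·-cong {b = a} {b′ = a} q^0≗1ₛ (λ _ → refl) n) (·-identityˡ a n)
q^-·-shift (suc e) a n = trans (q^suc-·-suc e a (e + n)) (q^-·-shift e a n)

q^-+ : ∀ a b → q^ a · q^ b ≗ q^ (a + b)
q^-+ zero    b n       = q^-·-shift 0 (q^ b) n
q^-+ (suc a) b zero    = q^suc-·-zero a (q^ b)
q^-+ (suc a) b (suc n) = trans (q^suc-·-suc a (q^ b) n) (q^-+ a b n)

oneMinusQ≗ : ∀ j → oneMinusQ (suc j) ≗ 1ₛ ⊕ ⊝ q^ suc j
oneMinusQ≗ j zero    = refl
oneMinusQ≗ j (suc n) with n ≡ᵇ j
... | true  = refl
... | false = refl

geomQ-indicator : ∀ j n → geomQ (suc j) n ≡ 1ₛ (n ℕ.% suc j)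
geomQ-indicator j n with n ℕ.% suc j
... | zero  = refl
... | suc _ = refl

geomQ-unfold : ∀ j → geomQ (suc j) ≗ 1ₛ ⊕ q^ suc j · geomQ (suc j)
geomQ-unfold j n with n ℕ.<? suc j
... | yes n<j+1 = begin
  geomQ (suc j) n                       ≡⟨ geomQ-indicator j n ⟩
  1ₛ (n ℕ.% suc j)                     ≡⟨ cong 1ₛ (m<n⇒m%n≡m n<j+1) ⟩
  1ₛ n                                 ≡⟨ ℤ.+-identityʳ (1ₛ n) ⟨
  1ₛ n ℤ.+ + 0                         ≡⟨ cong (ℤ._+_ (1ₛ n)) (q^-·-below (suc j) g n n<j+1) ⟨
  1ₛ n ℤ.+ (q^ suc j · g) n            ∎
  where
  open ≡.≡-Reasoning
  g = geomQ (suc j)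
... | no n≮j+1 = begin
  geomQ (suc j) n                             ≡⟨ cong g n≡ ⟩
  g (suc j + k)                               ≡⟨ geomQ-indicator j (suc j + k) ⟩
  1ₛ ((suc j + k) ℕ.% suc j)                 ≡⟨ cong (λ m → 1ₛ (m ℕ.% suc j)) (ℕ.+-comm (suc j) k) ⟩
  1ₛ ((k + suc j) ℕ.% suc j)                 ≡⟨ cong 1ₛ ([m+n]%n≡m%n k (suc j)) ⟩
  1ₛ (k ℕ.% suc j)                           ≡⟨ geomQ-indicator j k ⟨
  g k                                         ≡⟨ q^-·-shift (suc j) g k ⟨
  (q^ suc j · g) (suc j + k)                  ≡⟨ ℤ.+-identityˡ _ ⟨
  1ₛ (suc j + k) ℤ.+ (q^ suc j · g) (suc j + k) ≡⟨ cong (λ m → 1ₛ m ℤ.+ (q^ suc j · g) m) n≡ ⟨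
  1ₛ n ℤ.+ (q^ suc j · g) n                  ∎
  where
  open ≡.≡-Reasoning
  g = geomQ (suc j)
  k = n ∸ suc j
  n≡ : n ≡ suc j + k
  n≡ = sym (ℕ.m+[n∸m]≡n (ℕ.≮⇒≥ n≮j+1))

-- Shared by all truncation orders, so that one series can be compared at two different orders.
∑ ∏ : ℕ → (ℕ → Series) → Series
∑ = bigop _⊕_ 0ₛ
∏ = bigop _·_ 1ₛ

module Truncated (N : ℕ) where

  -- A record rather than a Π-type, so that its indices can be inferred by unification.
  infix 4 _≈_
  record _≈_ (a b : Series) : Set where
    constructor coeffs≡
    field coeff≡ : ∀ n → n ≤ N → a n ≡ b n
  open _≈_ public

  ≗⇒≈ : ∀ {a b} → a ≗ b → a ≈ b
  ≗⇒≈ a≗b = coeffs≡ (λ n _ → a≗b n)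

  isCommutativeRing : IsCommutativeRing _≈_ _⊕_ _·_ ⊝_ 0ₛ 1ₛ
  isCommutativeRing = record
    { isRing = record
      { +-isAbelianGroup = record
        { isGroup = record
          { isMonoid = record
            { isSemigroup = record
              { isMagma = record
                { isEquivalence = record
                  { refl  = coeffs≡ (λ n _ → refl)
                  ; sym   = λ a≈b → coeffs≡ (λ n n≤N → sym (coeff≡ a≈b n n≤N))
                  ; trans = λ a≈b b≈c → coeffs≡ (λ n n≤N → trans (coeff≡ a≈b n n≤N) (coeff≡ b≈c n n≤N)) }
                ; ∙-cong = λ a≈ b≈ → coeffs≡ (λ n n≤N → cong₂ ℤ._+_ (coeff≡ a≈ n n≤N) (coeff≡ b≈ n n≤N)) }
              ; assoc = λ a b c → ≗⇒≈ (λ n → ℤ.+-assoc (a n) (b n) (c n)) }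
            ; identity = (λ a → ≗⇒≈ (λ n → trans (cong (ℤ._+ a n) (0ₛ-coeff n)) (ℤ.+-identityˡ (a n))))
                       , (λ a → ≗⇒≈ (λ n → trans (cong (ℤ._+_ (a n)) (0ₛ-coeff n)) (ℤ.+-identityʳ (a n)))) }
          ; inverse = (λ a → ≗⇒≈ (λ n → trans (ℤ.+-inverseˡ (a n)) (sym (0ₛ-coeff n))))
                    , (λ a → ≗⇒≈ (λ n → trans (ℤ.+-inverseʳ (a n)) (sym (0ₛ-coeff n))))
          ; ⁻¹-cong = λ a≈ → coeffs≡ (λ n n≤N → cong ℤ.-_ (coeff≡ a≈ n n≤N)) }
        ; comm = λ a b → ≗⇒≈ (λ n → ℤ.+-comm (a n) (b n)) }
      ; *-cong = λ a≈ b≈ → coeffs≡ (λ n n≤N → ·-cong≤ n (λ i i≤n → coeff≡ a≈ i (ℕ.≤-trans i≤n n≤N)) (λ i i≤n → coeff≡ b≈ i (ℕ.≤-trans i≤n n≤N)))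
      ; *-assoc = λ a b c → ≗⇒≈ (·-assoc a b c)
      ; *-identity = (λ a → ≗⇒≈ (·-identityˡ a)) , (λ a → ≗⇒≈ (λ n → trans (·-comm a 1ₛ n) (·-identityˡ a n)))
      ; distrib = (λ a b c → ≗⇒≈ (λ n → trans (·-comm a (b ⊕ c) n) (trans (·-distribʳ b c a n) (cong₂ ℤ._+_ (·-comm b a n) (·-comm c a n)))))
                , (λ a b c → ≗⇒≈ (·-distribʳ b c a)) }
    ; *-comm = λ a b → ≗⇒≈ (·-comm a b) }

  commutativeRing : CommutativeRing 0ℓ 0ℓ
  commutativeRing = record { isCommutativeRing = isCommutativeRing }

  open CommutativeRing commutativeRing public
    using (setoid; +-cong; +-congˡ; +-congʳ; *-cong; *-congˡ; *-congʳ; -‿cong; *-commutativeMonoid)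
    renaming (refl to ≈-refl; sym to ≈-sym; trans to ≈-trans; reflexive to ≈-reflexive)

  private
    ring : ACR.AlmostCommutativeRing 0ℓ 0ℓ
    ring = ACR.fromCommutativeRing commutativeRing

    cst-morphism : CommutativeRing.rawRing ℤ.+-*-commutativeRing ACR.-Raw-AlmostCommutative⟶ ring
    cst-morphism = record
      { ⟦_⟧    = cst
      ; +-homo = λ k l → ≗⇒≈ (λ { zero → refl ; (suc n) → refl })
      ; *-homo = λ k l → ≗⇒≈ (λ { zero → sym (·-coeff-zero (cst k) (cst l)) ; (suc n) → sym (trans (cst-· k (cst l) (suc n)) (ℤ.*-zeroʳ k)) })
      ; -‿homo = λ k → ≗⇒≈ (λ { zero → refl ; (suc n) → refl })
      ; 0-homo = ≈-refl
      ; 1-homo = ≈-refl }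

    cst-≟ : ∀ k l → Maybe (cst k ≈ cst l)
    cst-≟ k l with k ℤ.≟ l
    ... | yes refl = just ≈-refl
    ... | no _     = nothing

  open Algebra.Solver.Ring (CommutativeRing.rawRing ℤ.+-*-commutativeRing) ring cst-morphism cst-≟ public
    using (solve; _:+_; _:*_; :-_; _:=_; con)

  cst-* : ∀ k l → cst (k ℤ.* l) ≈ cst k · cst l
  cst-* = ACR._-Raw-AlmostCommutative⟶_.*-homo cst-morphism

  open FiniteSums commutativeRing public hiding (∑; ∏)
  open Congruence commutativeRing public
  module ≈-Reasoning = SetoidReasoning setoid
  module mod-Reasoning (m : Series) = SetoidReasoning (CommutativeRing.setoid (quotientRing m))
  open ≈-Reasoning

  q^-vanish : ∀ {e} → N < e → q^ e ≈ 0ₛ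
  q^-vanish {e} N<e = coeffs≡ λ n n≤N →
    trans (sym (trans (·-comm (q^ e) 1ₛ n) (·-identityˡ (q^ e) n)))
          (trans (q^-·-below e 1ₛ n (ℕ.≤-<-trans n≤N N<e)) (sym (0ₛ-coeff n)))

  prodS-upTo : ∀ f K → prodS (map f (upTo K)) ≈ ∏ K f
  prodS-upTo f K = go f (λ i → i) K
    where
    go : ∀ f h K → prodS (map f (applyUpTo h K)) ≈ ∏ K (f ∘ h)
    go f h zero    = ≗⇒≈ (λ { zero → refl ; (suc _) → refl })
    go f h (suc K) = *-congˡ {f (h 0)} (go f (h ∘ suc) K)

  geomQ-inverse : ∀ j → (1ₛ ⊕ ⊝ q^ suc j) · geomQ (suc j) ≈ 1ₛ
  geomQ-inverse j = begin
    (1ₛ ⊕ ⊝ x) · g             ≈⟨ solve 2 (λ x g → (con (+ 1) :+ :- x) :* g := g :+ :- (x :* g)) ≈-refl x g ⟩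
    g ⊕ ⊝ (x · g)               ≈⟨ +-congʳ (≗⇒≈ (geomQ-unfold j)) ⟩
    (1ₛ ⊕ x · g) ⊕ ⊝ (x · g)   ≈⟨ solve 1 (λ y → (con (+ 1) :+ y) :+ :- y := con (+ 1)) ≈-refl (x · g) ⟩
    1ₛ                         ∎
    where
    x = q^ suc j
    g = geomQ (suc j)

  fT·fInvT≈1 : ∀ k → fT (suc k) N · fInvT (suc k) N ≈ 1ₛ
  fT·fInvT≈1 k = begin
    fT (suc k) N · fInvT (suc k) N                                  ≈⟨ *-cong (prodS-upTo _ N) (prodS-upTo _ N) ⟩
    ∏ N (λ i → oneMinusQ (suc k * suc i)) · ∏ N (λ i → geomQ (suc k * suc i))
                                                                    ≈⟨ ∏-merge N _ _ ⟨
    ∏ N (λ i → oneMinusQ (suc k * suc i) · geomQ (suc k * suc i))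
      ≈⟨ ∏-one N (λ i _ → ≈-trans (*-congʳ {geomQ (suc k * suc i)} (≗⇒≈ (oneMinusQ≗ (i + k * suc i)))) (geomQ-inverse (i + k * suc i))) ⟩
    1ₛ                                                             ∎

q^-cancel : ∀ c N {a b} → Truncated._≈_ (c + N) (q^ c · a) (q^ c · b) → Truncated._≈_ N a b
q^-cancel c N {a} {b} shifted = Truncated.coeffs≡ λ i i≤N →
  trans (sym (q^-·-shift c a i)) (trans (Truncated.coeff≡ shifted (c + i) (ℕ.+-monoʳ-≤ c i≤N)) (q^-·-shift c b i))

-- Gaussian binomials and a finite Jacobi triple product

infixr 8 _^_
_^_ : Series → ℕ → Series
a ^ k = ∏ k (λ _ → a)

sgn : ℕ → Series
sgn k = cst (-1ℤ ℤ.^ k)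

-- The Gaussian binomial coefficient [m, j] in the base q^(2d), by the q-Pascal rule.
gaussBinom : ℕ → ℕ → ℕ → Series
gaussBinom d zero    zero    = 1ₛ
gaussBinom d zero    (suc j) = 0ₛ
gaussBinom d (suc m) zero    = 1ₛ
gaussBinom d (suc m) (suc j) = q^ (d * (2 * (m ∸ j))) · gaussBinom d m j ⊕ gaussBinom d m (suc j)

m∸j≡1+m∸[1+j] : ∀ m j → j < m → m ∸ j ≡ suc (m ∸ suc j)
m∸j≡1+m∸[1+j] m j j<m = ℕ.+-∸-assoc 1 j<m

pascal-exponent : ∀ m j → j ≤ m → suc j * j + 2 * (m ∸ j) ≡ 2 * m + j * (j ∸ 1)
pascal-exponent m j j≤m = ≡.subst (λ m → suc j * j + 2 * (m ∸ j) ≡ 2 * m + j * (j ∸ 1)) (ℕ.m+[n∸m]≡n j≤m)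
  (trans (cong (λ r → suc j * j + 2 * r) (ℕ.m+n∸m≡n j (m ∸ j))) (shifted j (m ∸ j)))
  where
  shifted : ∀ j r → suc j * j + 2 * r ≡ 2 * (j + r) + j * (j ∸ 1)
  shifted zero    r = sym (ℕ.+-identityʳ (2 * r))
  shifted (suc i) r = expand i r
    where
    expand : ∀ i r → suc (suc i) * suc i + 2 * r ≡ 2 * (suc i + r) + suc i * i
    expand = ℕ-Solver.solve-∀

module Signs (N : ℕ) where
  open Truncated N
  open ≈-Reasoning

  sgn-suc : ∀ k → sgn (suc k) ≈ ⊝ sgn k
  sgn-suc k = ≈-trans (cst-* -1ℤ (-1ℤ ℤ.^ k)) (solve 1 (λ s → con -1ℤ :* s := :- s) ≈-refl (sgn k))

  sgn-+ : ∀ a b → sgn (a + b) ≈ sgn a · sgn b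
  sgn-+ a b = ≈-trans (≈-reflexive (cong cst (ℤ.^-distribˡ-+-* -1ℤ a b))) (cst-* (-1ℤ ℤ.^ a) (-1ℤ ℤ.^ b))

  sgn-square : ∀ k → sgn k · sgn k ≈ 1ₛ
  sgn-square zero    = solve 0 (con (+ 1) :* con (+ 1) := con (+ 1)) ≈-refl
  sgn-square (suc k) = begin
    sgn (suc k) · sgn (suc k)   ≈⟨ *-cong (sgn-suc k) (sgn-suc k) ⟩
    ⊝ sgn k · ⊝ sgn k           ≈⟨ solve 1 (λ s → :- s :* :- s := s :* s) ≈-refl (sgn k) ⟩
    sgn k · sgn k               ≈⟨ sgn-square k ⟩
    1ₛ                          ∎

module QBinomial (N d : ℕ) where
  open Truncated N
  open ≈-Reasoning
  open Signs N

  x^_ : ℕ → Series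
  x^ e = q^ (d * e)

  x^-+ : ∀ a b → x^ a · x^ b ≈ x^ (a + b)
  x^-+ a b = ≈-trans (≗⇒≈ (q^-+ (d * a) (d * b))) (≈-reflexive (cong q^_ (sym (ℕ.*-distribˡ-+ d a b))))

  x^-cong : ∀ {a b} → a ≡ b → x^ a ≈ x^ b
  x^-cong a≡b = ≈-reflexive (cong x^_ a≡b)

  x^0 : x^ 0 ≈ 1ₛ
  x^0 = ≈-trans (≈-reflexive (cong q^_ (ℕ.*-zeroʳ d))) (≗⇒≈ q^0≗1ₛ)

  x^-^ : ∀ a k → (x^ a) ^ k ≈ x^ (k * a)
  x^-^ a zero    = ≈-sym x^0
  x^-^ a (suc k) = ≈-trans (*-congˡ {x^ a} (x^-^ a k)) (x^-+ a (k * a))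

  poch : ℕ → Series
  poch k = ∏ k (λ i → 1ₛ ⊕ ⊝ x^ (2 * suc i))

  poch-suc : ∀ k → poch (suc k) ≈ poch k · (1ₛ ⊕ ⊝ x^ (2 * suc k))
  poch-suc k = ∏-snoc k (λ i → 1ₛ ⊕ ⊝ x^ (2 * suc i))

  gaussBinom-zero : ∀ m → gaussBinom d m 0 ≈ 1ₛ
  gaussBinom-zero zero    = ≈-refl
  gaussBinom-zero (suc m) = ≈-refl

  gaussBinom-above : ∀ m j → m < j → gaussBinom d m j ≈ 0ₛ
  gaussBinom-above zero    (suc j) _         = ≈-refl
  gaussBinom-above (suc m) (suc j) (s≤s m<j) = begin
    x^ (2 * (m ∸ j)) · gaussBinom d m j ⊕ gaussBinom d m (suc j)
      ≈⟨ +-cong (*-congˡ {x^ (2 * (m ∸ j))} (gaussBinom-above m j m<j)) (gaussBinom-above m (suc j) (ℕ.m≤n⇒m≤1+n m<j)) ⟩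
    x^ (2 * (m ∸ j)) · 0ₛ ⊕ 0ₛ
      ≈⟨ solve 1 (λ a → a :* con (+ 0) :+ con (+ 0) := con (+ 0)) ≈-refl (x^ (2 * (m ∸ j))) ⟩
    0ₛ ∎

  gaussBinom-poch : ∀ m j → j ≤ m → gaussBinom d m j · poch j · poch (m ∸ j) ≈ poch m
  gaussBinom-poch zero    zero    _         = solve 0 (con (+ 1) :* con (+ 1) :* con (+ 1) := con (+ 1)) ≈-refl
  gaussBinom-poch (suc m) zero    _         = solve 1 (λ p → con (+ 1) :* con (+ 1) :* p := p) ≈-refl (poch (suc m))
  gaussBinom-poch (suc m) (suc j) (s≤s j≤m) = begin
    (A · b₀ ⊕ b₁) · poch (suc j) · poch (m ∸ j)            ≈⟨ solve 5 (λ A a b S R → (A :* a :+ b) :* S :* R := A :* (a :* S :* R) :+ b :* S :* R) ≈-refl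
                                                                 A b₀ b₁ (poch (suc j)) (poch (m ∸ j)) ⟩
    A · (b₀ · poch (suc j) · poch (m ∸ j)) ⊕ b₁ · poch (suc j) · poch (m ∸ j)
                                                             ≈⟨ +-congʳ {b₁ · poch (suc j) · poch (m ∸ j)} (*-congˡ {A} first) ⟩
    A · ((1ₛ ⊕ ⊝ B) · poch m) ⊕ b₁ · poch (suc j) · poch (m ∸ j)
                                                             ≈⟨ second (ℕ.m≤n⇒m<n∨m≡n j≤m) ⟩
    poch (suc m)                                             ∎
    where
    A  = x^ (2 * (m ∸ j))
    B  = x^ (2 * suc j)
    b₀ = gaussBinom d m j
    b₁ = gaussBinom d m (suc j)
    first : b₀ · poch (suc j) · poch (m ∸ j) ≈ (1ₛ ⊕ ⊝ B) · poch m
    first = begin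
      b₀ · poch (suc j) · poch (m ∸ j)               ≈⟨ *-congʳ {poch (m ∸ j)} (*-congˡ {b₀} (poch-suc j)) ⟩
      b₀ · (poch j · (1ₛ ⊕ ⊝ B)) · poch (m ∸ j)
        ≈⟨ solve 4 (λ a q c r → a :* (q :* c) :* r := c :* (a :* q :* r)) ≈-refl b₀ (poch j) (1ₛ ⊕ ⊝ B) (poch (m ∸ j)) ⟩
      (1ₛ ⊕ ⊝ B) · (b₀ · poch j · poch (m ∸ j))      ≈⟨ *-congˡ {1ₛ ⊕ ⊝ B} (gaussBinom-poch m j j≤m) ⟩
      (1ₛ ⊕ ⊝ B) · poch m                            ∎
    A·B : A · B ≈ x^ (2 * suc m)
    A·B = ≈-trans (x^-+ _ _) (x^-cong (trans (sym (ℕ.*-distribˡ-+ 2 (m ∸ j) (suc j)))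
                                                (cong (2 *_) (trans (ℕ.+-suc (m ∸ j) j) (cong suc (ℕ.m∸n+n≡m j≤m))))))
    second : j < m ⊎ j ≡ m → A · ((1ₛ ⊕ ⊝ B) · poch m) ⊕ b₁ · poch (suc j) · poch (m ∸ j) ≈ poch (suc m)
    second (inj₁ j<m) = begin
      A · ((1ₛ ⊕ ⊝ B) · poch m) ⊕ b₁ · poch (suc j) · poch (m ∸ j)
        ≈⟨ +-congˡ {A · ((1ₛ ⊕ ⊝ B) · poch m)} (*-congˡ {b₁ · poch (suc j)} (≈-trans (≈-reflexive (cong poch (m∸j≡1+m∸[1+j] m j j<m))) (poch-suc (m ∸ suc j)))) ⟩
      A · ((1ₛ ⊕ ⊝ B) · poch m) ⊕ b₁ · poch (suc j) · (poch (m ∸ suc j) · (1ₛ ⊕ ⊝ x^ (2 * suc (m ∸ suc j))))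
        ≈⟨ +-congˡ {A · ((1ₛ ⊕ ⊝ B) · poch m)} (*-congˡ {b₁ · poch (suc j)} (*-congˡ {poch (m ∸ suc j)}
             (+-congˡ {1ₛ} (-‿cong (x^-cong (cong (2 *_) (sym (m∸j≡1+m∸[1+j] m j j<m)))))))) ⟩
      A · ((1ₛ ⊕ ⊝ B) · poch m) ⊕ b₁ · poch (suc j) · (poch (m ∸ suc j) · (1ₛ ⊕ ⊝ A))
        ≈⟨ +-congˡ {A · ((1ₛ ⊕ ⊝ B) · poch m)} (solve 4 (λ b s r c → b :* s :* (r :* c) := b :* s :* r :* c) ≈-refl b₁ (poch (suc j)) (poch (m ∸ suc j)) (1ₛ ⊕ ⊝ A)) ⟩
      A · ((1ₛ ⊕ ⊝ B) · poch m) ⊕ b₁ · poch (suc j) · poch (m ∸ suc j) · (1ₛ ⊕ ⊝ A)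
        ≈⟨ +-congˡ {A · ((1ₛ ⊕ ⊝ B) · poch m)} (*-congʳ {1ₛ ⊕ ⊝ A} (gaussBinom-poch m (suc j) j<m)) ⟩
      A · ((1ₛ ⊕ ⊝ B) · poch m) ⊕ poch m · (1ₛ ⊕ ⊝ A)
        ≈⟨ solve 3 (λ A B P → A :* ((con (+ 1) :+ :- B) :* P) :+ P :* (con (+ 1) :+ :- A) := P :* (con (+ 1) :+ :- (A :* B))) ≈-refl A B (poch m) ⟩
      poch m · (1ₛ ⊕ ⊝ (A · B))
        ≈⟨ *-congˡ {poch m} (+-congˡ {1ₛ} (-‿cong A·B)) ⟩
      poch m · (1ₛ ⊕ ⊝ x^ (2 * suc m))
        ≈⟨ poch-suc m ⟨
      poch (suc m) ∎
    second (inj₂ refl) = begin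
      A · ((1ₛ ⊕ ⊝ B) · poch m) ⊕ b₁ · poch (suc j) · poch (m ∸ j)
        ≈⟨ +-cong (*-congʳ {(1ₛ ⊕ ⊝ B) · poch m} (≈-trans (x^-cong (cong (2 *_) (ℕ.n∸n≡0 j))) x^0))
                  (*-congʳ {poch (m ∸ j)} (*-congʳ {poch (suc j)} (gaussBinom-above j (suc j) (ℕ.n<1+n j)))) ⟩
      1ₛ · ((1ₛ ⊕ ⊝ B) · poch m) ⊕ 0ₛ · poch (suc j) · poch (m ∸ j)
        ≈⟨ solve 4 (λ B P S R → con (+ 1) :* ((con (+ 1) :+ :- B) :* P) :+ con (+ 0) :* S :* R := P :* (con (+ 1) :+ :- B))
                   ≈-refl B (poch m) (poch (suc j)) (poch (m ∸ j)) ⟩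
      poch m · (1ₛ ⊕ ⊝ B)
        ≈⟨ poch-suc m ⟨
      poch (suc m) ∎

  qBinomialTerm : Series → ℕ → ℕ → Series
  qBinomialTerm w m j = sgn j · x^ (j * (j ∸ 1)) · gaussBinom d m j · w ^ (m ∸ j)

  qBinomialTheorem : ∀ w m → ∑ (suc m) (qBinomialTerm w m) ≈ ∏ m (λ i → w ⊕ ⊝ x^ (2 * i))
  qBinomialTheorem w zero = begin
    sgn 0 · x^ 0 · 1ₛ · 1ₛ ⊕ 0ₛ    ≈⟨ +-congʳ {0ₛ} (*-congʳ {1ₛ} (*-congʳ {1ₛ} (*-congˡ {sgn 0} x^0))) ⟩
    sgn 0 · 1ₛ · 1ₛ · 1ₛ ⊕ 0ₛ      ≈⟨ solve 0 (con (+ 1) :* con (+ 1) :* con (+ 1) :* con (+ 1) :+ con (+ 0) := con (+ 1)) ≈-refl ⟩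
    1ₛ                              ∎
  qBinomialTheorem w (suc m) = begin
    T (suc m) 0 ⊕ ∑ (suc m) (T (suc m) ∘ suc)           ≈⟨ +-congˡ {T (suc m) 0} (∑-cong (suc m) (λ j _ → pascal j)) ⟩
    T (suc m) 0 ⊕ ∑ (suc m) (λ j → t₁ j ⊕ t₂ j)         ≈⟨ +-congˡ {T (suc m) 0} (∑-merge (suc m) t₁ t₂) ⟩
    T (suc m) 0 ⊕ (∑ (suc m) t₁ ⊕ ∑ (suc m) t₂)         ≈⟨ +-congˡ {T (suc m) 0} (+-cong sum₁ sum₂) ⟩
    T (suc m) 0 ⊕ (⊝ X · S m ⊕ ∑ m t₂)                  ≈⟨ solve 3 (λ a b c → a :+ (b :+ c) := (a :+ c) :+ b) ≈-refl (T (suc m) 0) (⊝ X · S m) (∑ m t₂) ⟩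
    (T (suc m) 0 ⊕ ∑ m t₂) ⊕ ⊝ X · S m                  ≈⟨ +-congʳ {⊝ X · S m} w·S ⟨
    w · S m ⊕ ⊝ X · S m                                 ≈⟨ solve 3 (λ w x b → w :* b :+ :- x :* b := b :* (w :+ :- x)) ≈-refl w X (S m) ⟩
    S m · (w ⊕ ⊝ X)                                     ≈⟨ *-congʳ {w ⊕ ⊝ X} (qBinomialTheorem w m) ⟩
    ∏ m (λ i → w ⊕ ⊝ x^ (2 * i)) · (w ⊕ ⊝ X)           ≈⟨ ∏-snoc m (λ i → w ⊕ ⊝ x^ (2 * i)) ⟨
    ∏ (suc m) (λ i → w ⊕ ⊝ x^ (2 * i))                 ∎
    where
    T = qBinomialTerm w
    S = λ m → ∑ (suc m) (T m)
    X = x^ (2 * m)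
    t₁ t₂ : ℕ → Series
    t₁ j = sgn (suc j) · x^ (suc j * j) · x^ (2 * (m ∸ j)) · gaussBinom d m j · w ^ (m ∸ j)
    t₂ j = sgn (suc j) · x^ (suc j * j) · gaussBinom d m (suc j) · w ^ (m ∸ j)
    pascal : ∀ j → T (suc m) (suc j) ≈ t₁ j ⊕ t₂ j
    pascal j = solve 6 (λ s x y a b p → s :* x :* (y :* a :+ b) :* p := s :* x :* y :* a :* p :+ s :* x :* b :* p) ≈-refl
      (sgn (suc j)) (x^ (suc j * j)) (x^ (2 * (m ∸ j))) (gaussBinom d m j) (gaussBinom d m (suc j)) (w ^ (m ∸ j))
    t₁≈ : ∀ j → j < suc m → t₁ j ≈ ⊝ X · T m j
    t₁≈ j (s≤s j≤m) = begin
      sgn (suc j) · x^ (suc j * j) · x^ (2 * (m ∸ j)) · b · p     ≈⟨ solve 5 (λ s x y a p → s :* x :* y :* a :* p := s :* (x :* y) :* a :* p) ≈-refl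
                                                                       (sgn (suc j)) (x^ (suc j * j)) (x^ (2 * (m ∸ j))) b p ⟩
      sgn (suc j) · (x^ (suc j * j) · x^ (2 * (m ∸ j))) · b · p   ≈⟨ *-congʳ {p} (*-congʳ {b} (*-cong (sgn-suc j) exponents)) ⟩
      ⊝ sgn j · (X · x^ (j * (j ∸ 1))) · b · p                    ≈⟨ solve 5 (λ s x y a p → :- s :* (x :* y) :* a :* p := :- x :* (s :* y :* a :* p)) ≈-refl
                                                                       (sgn j) X (x^ (j * (j ∸ 1))) b p ⟩
      ⊝ X · T m j                                                 ∎
      where
      b = gaussBinom d m j
      p = w ^ (m ∸ j)
      exponents : x^ (suc j * j) · x^ (2 * (m ∸ j)) ≈ X · x^ (j * (j ∸ 1))
      exponents = ≈-trans (x^-+ _ _) (≈-trans (x^-cong (pascal-exponent m j j≤m)) (≈-sym (x^-+ _ _)))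
    sum₁ : ∑ (suc m) t₁ ≈ ⊝ X · S m
    sum₁ = ≈-trans (∑-cong (suc m) t₁≈) (≈-sym (∑-distribˡ (suc m) (⊝ X) (T m)))
    sum₂ : ∑ (suc m) t₂ ≈ ∑ m t₂
    sum₂ = begin
      ∑ (suc m) t₂                    ≈⟨ ∑-snoc m t₂ ⟩
      ∑ m t₂ ⊕ t₂ m
        ≈⟨ +-congˡ {∑ m t₂} (*-congʳ {w ^ (m ∸ m)} (*-congˡ {sgn (suc m) · x^ (suc m * m)} (gaussBinom-above m (suc m) (ℕ.n<1+n m)))) ⟩
      ∑ m t₂ ⊕ sgn (suc m) · x^ (suc m * m) · 0ₛ · w ^ (m ∸ m)
                                      ≈⟨ solve 4 (λ s a b p → s :+ a :* b :* con (+ 0) :* p := s) ≈-refl (∑ m t₂) (sgn (suc m)) (x^ (suc m * m)) (w ^ (m ∸ m)) ⟩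
      ∑ m t₂                          ∎
    w·T≈t₂ : ∀ j → j < m → w · T m (suc j) ≈ t₂ j
    w·T≈t₂ j j<m = begin
      w · (sgn (suc j) · x^ (suc j * j) · gaussBinom d m (suc j) · w ^ (m ∸ suc j))
        ≈⟨ solve 5 (λ w s x a p → w :* (s :* x :* a :* p) := s :* x :* a :* (w :* p)) ≈-refl w (sgn (suc j)) (x^ (suc j * j)) (gaussBinom d m (suc j)) (w ^ (m ∸ suc j)) ⟩
      sgn (suc j) · x^ (suc j * j) · gaussBinom d m (suc j) · w ^ suc (m ∸ suc j)
        ≈⟨ *-congˡ {sgn (suc j) · x^ (suc j * j) · gaussBinom d m (suc j)} (≈-reflexive (cong (w ^_) (m∸j≡1+m∸[1+j] m j j<m))) ⟨
      t₂ j ∎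
    w·S : w · S m ≈ T (suc m) 0 ⊕ ∑ m t₂
    w·S = begin
      w · S m                                        ≈⟨ ∑-distribˡ (suc m) w (T m) ⟩
      w · T m 0 ⊕ ∑ m (λ j → w · T m (suc j))        ≈⟨ +-cong w·T₀ (∑-cong m w·T≈t₂) ⟩
      T (suc m) 0 ⊕ ∑ m t₂                           ∎
      where
      w·T₀ : w · T m 0 ≈ T (suc m) 0
      w·T₀ = begin
        w · (sgn 0 · x^ 0 · gaussBinom d m 0 · w ^ m)  ≈⟨ *-congˡ {w} (*-congʳ {w ^ m} (*-congˡ {sgn 0 · x^ 0} (gaussBinom-zero m))) ⟩
        w · (sgn 0 · x^ 0 · 1ₛ · w ^ m)
          ≈⟨ solve 4 (λ w s x p → w :* (s :* x :* con (+ 1) :* p) := s :* x :* con (+ 1) :* (w :* p)) ≈-refl w (sgn 0) (x^ 0) (w ^ m) ⟩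
        sgn 0 · x^ 0 · 1ₛ · w ^ suc m                  ∎

-- With x = q^d, w = x^(2n−1) and m = 2n, the j-th term of the q-binomial sum carries x^(termExponent n j),
-- and all terms share the factor x^(tripleProductExponent n).
tripleProductExponent : ℕ → ℕ
tripleProductExponent n = n * (n ∸ 1) + n * (2 * n ∸ 1)

termExponent : ℕ → ℕ → ℕ
termExponent n j = j * (j ∸ 1) + (2 * n ∸ j) * (2 * n ∸ 1)

private
  2[1+x]∸1 : ∀ x → 2 * suc x ∸ 1 ≡ 2 * x + 1
  2[1+x]∸1 x = expand x
    where
    expand : ∀ x → x + (suc x + 0) ≡ 2 * x + 1
    expand = ℕ-Solver.solve-∀

  2[1+k+a]∸a : ∀ k a → 2 * suc (k + a) ∸ a ≡ a + 2 * suc k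
  2[1+k+a]∸a k a = trans (cong (_∸ a) (expand k a)) (ℕ.m+n∸m≡n a (a + 2 * suc k))
    where
    expand : ∀ k a → 2 * suc (k + a) ≡ a + (a + 2 * suc k)
    expand = ℕ-Solver.solve-∀

  2[1+k+a]∸[2+2k+a] : ∀ k a → 2 * suc (k + a) ∸ (suc (k + a) + suc k) ≡ a
  2[1+k+a]∸[2+2k+a] k a = trans (cong (_∸ (suc (k + a) + suc k)) (expand k a)) (ℕ.m+n∸m≡n (suc (k + a) + suc k) a)
    where
    expand : ∀ k a → 2 * suc (k + a) ≡ (suc (k + a) + suc k) + a
    expand = ℕ-Solver.solve-∀

  termExponent-below′ : ∀ k a → termExponent (suc (k + a)) (k + a ∸ k) ≡ tripleProductExponent (suc (k + a)) + suc k * suc k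
  termExponent-below′ k a rewrite ℕ.m+n∸m≡n k a | 2[1+k+a]∸a k a | 2[1+x]∸1 (k + a) with a
  ... | zero  = expand₀ k
    where
    expand₀ : ∀ k → (0 + 2 * suc k) * (2 * (k + 0) + 1) ≡ suc (k + 0) * (k + 0) + suc (k + 0) * (2 * (k + 0) + 1) + suc k * suc k
    expand₀ = ℕ-Solver.solve-∀
  ... | suc b = expand₁ k b
    where
    expand₁ : ∀ k b → suc b * b + (suc b + 2 * suc k) * (2 * (k + suc b) + 1)
                    ≡ suc (k + suc b) * (k + suc b) + suc (k + suc b) * (2 * (k + suc b) + 1) + suc k * suc k
    expand₁ = ℕ-Solver.solve-∀

  termExponent-above′ : ∀ k a → termExponent (suc (k + a)) (suc (k + a) + suc k) ≡ tripleProductExponent (suc (k + a)) + suc k * suc k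
  termExponent-above′ k a rewrite 2[1+k+a]∸[2+2k+a] k a | 2[1+x]∸1 (k + a) = expand k a
    where
    expand : ∀ k a → (suc (k + a) + suc k) * ((k + a) + suc k) + a * (2 * (k + a) + 1)
                   ≡ suc (k + a) * (k + a) + suc (k + a) * (2 * (k + a) + 1) + suc k * suc k
    expand = ℕ-Solver.solve-∀

termExponent-middle : ∀ n → termExponent n n ≡ tripleProductExponent n
termExponent-middle n rewrite ℕ.m+n∸m≡n n (n + 0) | ℕ.+-identityʳ n = refl

termExponent-below : ∀ n k → k < n → termExponent n (n ∸ suc k) ≡ tripleProductExponent n + suc k * suc k
termExponent-below n k k<n =
  ≡.subst (λ n → termExponent n (n ∸ suc k) ≡ tripleProductExponent n + suc k * suc k) (ℕ.m+[n∸m]≡n k<n) (termExponent-below′ k (n ∸ suc k))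

termExponent-above : ∀ n k → k < n → termExponent n (n + suc k) ≡ tripleProductExponent n + suc k * suc k
termExponent-above n k k<n =
  ≡.subst (λ n → termExponent n (n + suc k) ≡ tripleProductExponent n + suc k * suc k) (ℕ.m+[n∸m]≡n k<n) (termExponent-above′ k (n ∸ suc k))

private
  2i+[2[n∸1∸i]+1]≡2n∸1 : ∀ n i → i < n → 2 * i + suc (2 * (n ∸ suc i)) ≡ 2 * n ∸ 1
  2i+[2[n∸1∸i]+1]≡2n∸1 n i i<n =
    ≡.subst (λ n → 2 * i + suc (2 * (n ∸ suc i)) ≡ 2 * n ∸ 1) (ℕ.m+[n∸m]≡n i<n) (shifted i (n ∸ suc i))
    where
    expand : ∀ i a → 2 * i + suc (2 * a) ≡ 2 * (i + a) + 1
    expand = ℕ-Solver.solve-∀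
    shifted : ∀ i a → 2 * i + suc (2 * (i + a ∸ i)) ≡ 2 * suc (i + a) ∸ 1
    shifted i a rewrite ℕ.m+n∸m≡n i a | 2[1+x]∸1 (i + a) = expand i a

  [2n∸1]+[2k+1]≡2[n+k] : ∀ p k → (2 * suc p ∸ 1) + suc (2 * k) ≡ 2 * (suc p + k)
  [2n∸1]+[2k+1]≡2[n+k] p k rewrite 2[1+x]∸1 p = expand p k
    where
    expand : ∀ p k → 2 * p + 1 + suc (2 * k) ≡ 2 * (suc p + k)
    expand = ℕ-Solver.solve-∀

  k[k∸1]+2k≡[k+1]k : ∀ k → k * (k ∸ 1) + 2 * k ≡ suc k * k
  k[k∸1]+2k≡[k+1]k zero    = refl
  k[k∸1]+2k≡[k+1]k (suc k) = expand k
    where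
    expand : ∀ k → suc k * k + 2 * suc k ≡ suc (suc k) * suc k
    expand = ℕ-Solver.solve-∀

module TripleProduct (M d p : ℕ) where
  open Truncated M
  open ≈-Reasoning
  open Signs M
  open QBinomial M d

  n : ℕ
  n = suc p

  w : Series
  w = x^ (2 * n ∸ 1)

  odd : ℕ → Series
  odd i = 1ₛ ⊕ ⊝ x^ suc (2 * i)

  oddPoch : Series
  oddPoch = ∏ n odd

  ∏-neg-even : ∀ K → ∏ K (λ i → ⊝ x^ (2 * i)) ≈ sgn K · x^ (K * (K ∸ 1))
  ∏-neg-even zero    = ≈-trans (solve 0 (con (+ 1) := con (+ 1) :* con (+ 1)) ≈-refl) (*-congˡ {sgn 0} (≈-sym x^0))
  ∏-neg-even (suc K) = begin
    ∏ (suc K) (λ i → ⊝ x^ (2 * i))                ≈⟨ ∏-snoc K (λ i → ⊝ x^ (2 * i)) ⟩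
    ∏ K (λ i → ⊝ x^ (2 * i)) · ⊝ x^ (2 * K)       ≈⟨ *-congʳ {⊝ x^ (2 * K)} (∏-neg-even K) ⟩
    sgn K · x^ (K * (K ∸ 1)) · ⊝ x^ (2 * K)       ≈⟨ solve 3 (λ s x y → s :* x :* :- y := :- s :* (x :* y)) ≈-refl (sgn K) (x^ (K * (K ∸ 1))) (x^ (2 * K)) ⟩
    ⊝ sgn K · (x^ (K * (K ∸ 1)) · x^ (2 * K))     ≈⟨ *-cong (≈-sym (sgn-suc K)) (≈-trans (x^-+ _ _) (x^-cong (k[k∸1]+2k≡[k+1]k K))) ⟩
    sgn (suc K) · x^ (suc K * K)                  ∎

  productSide : ∏ (2 * n) (λ i → w ⊕ ⊝ x^ (2 * i)) ≈ sgn n · x^ (tripleProductExponent n) · oddPoch · oddPoch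
  productSide = begin
    ∏ (2 * n) h                                                 ≈⟨ ≈-reflexive (cong (λ m → ∏ (n + m) h) (ℕ.+-identityʳ n)) ⟩
    ∏ (n + n) h                                                 ≈⟨ ∏-split n n h ⟩
    ∏ n h · ∏ n (λ k → h (n + k))                               ≈⟨ *-cong (∏-cong n lower) (∏-cong n upper) ⟩
    ∏ n (λ i → ⊝ x^ (2 * i) · odd (n ∸ suc i)) · ∏ n (λ k → w · odd k)
                                                                ≈⟨ *-cong (∏-merge n (λ i → ⊝ x^ (2 * i)) (λ i → odd (n ∸ suc i))) (∏-merge n (λ _ → w) odd) ⟩
    (∏ n (λ i → ⊝ x^ (2 * i)) · ∏ n (λ i → odd (n ∸ suc i))) · (w ^ n · oddPoch)
                                                                ≈⟨ *-cong (*-cong (∏-neg-even n) (≈-sym (∏-reverse n odd))) (*-congʳ {oddPoch} (x^-^ (2 * n ∸ 1) n)) ⟩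
    (sgn n · x^ (n * (n ∸ 1)) · oddPoch) · (x^ (n * (2 * n ∸ 1)) · oddPoch)
                                                                ≈⟨ solve 4 (λ s x y o → (s :* x :* o) :* (y :* o) := s :* (x :* y) :* o :* o) ≈-refl
                                                                     (sgn n) (x^ (n * (n ∸ 1))) (x^ (n * (2 * n ∸ 1))) oddPoch ⟩
    sgn n · (x^ (n * (n ∸ 1)) · x^ (n * (2 * n ∸ 1))) · oddPoch · oddPoch
                                                                ≈⟨ *-congʳ {oddPoch} (*-congʳ {oddPoch} (*-congˡ {sgn n} (x^-+ _ _))) ⟩
    sgn n · x^ (tripleProductExponent n) · oddPoch · oddPoch               ∎
    where
    h : ℕ → Series
    h i = w ⊕ ⊝ x^ (2 * i)
    lower : ∀ i → i < n → h i ≈ ⊝ x^ (2 * i) · odd (n ∸ suc i)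
    lower i i<n = ≈-sym (begin
      ⊝ x^ (2 * i) · (1ₛ ⊕ ⊝ x^ suc (2 * (n ∸ suc i)))
        ≈⟨ solve 2 (λ x y → :- x :* (con (+ 1) :+ :- y) := x :* y :+ :- x) ≈-refl (x^ (2 * i)) (x^ suc (2 * (n ∸ suc i))) ⟩
      x^ (2 * i) · x^ suc (2 * (n ∸ suc i)) ⊕ ⊝ x^ (2 * i)           ≈⟨ +-congʳ {⊝ x^ (2 * i)} (≈-trans (x^-+ _ _) (x^-cong (2i+[2[n∸1∸i]+1]≡2n∸1 n i i<n))) ⟩
      w ⊕ ⊝ x^ (2 * i)                                               ∎)
    upper : ∀ k → k < n → h (n + k) ≈ w · odd k
    upper k _ = ≈-sym (begin
      w · (1ₛ ⊕ ⊝ x^ suc (2 * k))           ≈⟨ solve 2 (λ x y → x :* (con (+ 1) :+ :- y) := x :+ :- (x :* y)) ≈-refl w (x^ suc (2 * k)) ⟩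
      w ⊕ ⊝ (w · x^ suc (2 * k))            ≈⟨ +-congˡ {w} (-‿cong (≈-trans (x^-+ _ _) (x^-cong ([2n∸1]+[2k+1]≡2[n+k] p k)))) ⟩
      w ⊕ ⊝ x^ (2 * (n + k))                ∎)

  belowTerm aboveTerm : ℕ → Series
  belowTerm k = sgn (n ∸ suc k) · x^ (suc k * suc k) · gaussBinom d (2 * n) (n ∸ suc k)
  aboveTerm k = sgn (n + suc k) · x^ (suc k * suc k) · gaussBinom d (2 * n) (n + suc k)

  below middle above : Series
  below  = ∑ n belowTerm
  middle = sgn n · x^ 0 · gaussBinom d (2 * n) n
  above  = ∑ n aboveTerm

  symmetricSum : Series
  symmetricSum = below ⊕ middle ⊕ above

  sumSide : ∑ (suc (2 * n)) (qBinomialTerm w (2 * n)) ≈ x^ (tripleProductExponent n) · symmetricSum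
  sumSide = begin
    ∑ (suc (2 * n)) T                                                     ≈⟨ ≈-reflexive (cong (λ m → ∑ m T) 1+2n≡n+[1+n]) ⟩
    ∑ (n + suc n) T                                                       ≈⟨ ∑-split n (suc n) T ⟩
    ∑ n T ⊕ (T (n + 0) ⊕ ∑ n (λ k → T (n + suc k)))
      ≈⟨ +-cong (∑-reverse n T) (+-congʳ {∑ n (λ k → T (n + suc k))} (≈-reflexive (cong T (ℕ.+-identityʳ n)))) ⟩
    ∑ n (λ k → T (n ∸ suc k)) ⊕ (T n ⊕ ∑ n (λ k → T (n + suc k)))
      ≈⟨ +-cong (∑-cong n (λ k k<n → factor (n ∸ suc k) (suc k * suc k) (termExponent-below n k k<n)))
                (+-cong (factor n 0 (trans (termExponent-middle n) (sym (ℕ.+-identityʳ (tripleProductExponent n)))))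
                        (∑-cong n (λ k k<n → factor (n + suc k) (suc k * suc k) (termExponent-above n k k<n)))) ⟩
    ∑ n (λ k → X · belowTerm k) ⊕ (X · middle ⊕ ∑ n (λ k → X · aboveTerm k))
      ≈⟨ +-cong (≈-sym (∑-distribˡ n X belowTerm)) (+-congˡ {X · middle} (≈-sym (∑-distribˡ n X aboveTerm))) ⟩
    X · below ⊕ (X · middle ⊕ X · above)
      ≈⟨ solve 4 (λ x a b c → x :* a :+ (x :* b :+ x :* c) := x :* (a :+ b :+ c)) ≈-refl X below middle above ⟩
    X · symmetricSum                                                      ∎
    where
    T = qBinomialTerm w (2 * n)
    X = x^ (tripleProductExponent n)
    1+2n≡n+[1+n] : suc (2 * n) ≡ n + suc n
    1+2n≡n+[1+n] = trans (cong (λ m → suc (n + m)) (ℕ.+-identityʳ n)) (sym (ℕ.+-suc n n))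
    factor : ∀ j e → termExponent n j ≡ tripleProductExponent n + e → T j ≈ X · (sgn j · x^ e · gaussBinom d (2 * n) j)
    factor j e exponent = begin
      sgn j · x^ (j * (j ∸ 1)) · b · w ^ (2 * n ∸ j)                    ≈⟨ *-congˡ {sgn j · x^ (j * (j ∸ 1)) · b} (x^-^ (2 * n ∸ 1) (2 * n ∸ j)) ⟩
      sgn j · x^ (j * (j ∸ 1)) · b · x^ ((2 * n ∸ j) * (2 * n ∸ 1))     ≈⟨ solve 4 (λ s x q y → s :* x :* q :* y := s :* (x :* y) :* q) ≈-refl
                                                                             (sgn j) (x^ (j * (j ∸ 1))) b (x^ ((2 * n ∸ j) * (2 * n ∸ 1))) ⟩
      sgn j · (x^ (j * (j ∸ 1)) · x^ ((2 * n ∸ j) * (2 * n ∸ 1))) · b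
        ≈⟨ *-congʳ {b} (*-congˡ {sgn j} (≈-trans (x^-+ _ _) (≈-trans (x^-cong exponent) (≈-sym (x^-+ _ _))))) ⟩
      sgn j · (X · x^ e) · b
        ≈⟨ solve 4 (λ s x y q → s :* (x :* y) :* q := x :* (s :* y :* q)) ≈-refl (sgn j) X (x^ e) b ⟩
      X · (sgn j · x^ e · b)                                            ∎
      where b = gaussBinom d (2 * n) j

  symmetricSum-shifted : x^ (tripleProductExponent n) · symmetricSum ≈ x^ (tripleProductExponent n) · (sgn n · oddPoch · oddPoch)
  symmetricSum-shifted = begin
    x^ (tripleProductExponent n) · symmetricSum                          ≈⟨ sumSide ⟨
    ∑ (suc (2 * n)) (qBinomialTerm w (2 * n))                ≈⟨ qBinomialTheorem w (2 * n) ⟩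
    ∏ (2 * n) (λ i → w ⊕ ⊝ x^ (2 * i))                      ≈⟨ productSide ⟩
    sgn n · x^ (tripleProductExponent n) · oddPoch · oddPoch
      ≈⟨ solve 3 (λ s x o → s :* x :* o :* o := x :* (s :* o :* o)) ≈-refl (sgn n) (x^ (tripleProductExponent n)) oddPoch ⟩
    x^ (tripleProductExponent n) · (sgn n · oddPoch · oddPoch)           ∎

-- Gauss's identity φ(−q^d) f_{2d} = f_d²

phiTerm : ℕ → ℕ → Series
phiTerm d k = sgn (suc k) · q^ (d * (suc k * suc k))

phiTail : ℕ → ℕ → Series
phiTail d N = ∑ (suc N) (phiTerm d)

phi : ℕ → ℕ → Series
phi d N = 1ₛ ⊕ cst (+ 2) · phiTail d N

module GaussIdentity (N d′ : ℕ) where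
  d : ℕ
  d = suc d′

  open Truncated N
  open ≈-Reasoning
  open Signs N
  open QBinomial N d
  open TripleProduct N d (2 * N)

  x^-vanish : ∀ {e} → N < e → x^ e ≈ 0ₛ
  x^-vanish {e} N<e = q^-vanish (ℕ.<-≤-trans N<e (ℕ.m≤n*m e d))

  F : Series
  F = poch N

  poch-stable : ∀ {k} → N ≤ k → poch k ≈ F
  poch-stable N≤k = ∏-extend (λ i → 1ₛ ⊕ ⊝ x^ (2 * suc i)) N≤k (λ i N≤i →
    ≈-trans (+-congˡ {1ₛ} (-‿cong (x^-vanish (ℕ.<-≤-trans (s≤s N≤i) (ℕ.m≤n*m (suc i) 2)))))
            (solve 0 (con (+ 1) :+ :- con (+ 0) := con (+ 1)) ≈-refl))

  fT-d : fT d N ≈ ∏ N (λ i → 1ₛ ⊕ ⊝ x^ suc i)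
  fT-d = ≈-trans (prodS-upTo _ N) (∏-cong N (λ i _ → ≗⇒≈ (oneMinusQ≗ _)))

  fT-2d : fT (2 * d) N ≈ F
  fT-2d = ≈-trans (prodS-upTo _ N) (∏-cong N (λ i _ → ≈-trans (≗⇒≈ (oneMinusQ≗ _)) (+-congˡ {1ₛ} (-‿cong (≈-reflexive (cong q^_ (reassoc d′ i)))))))
    where
    reassoc : ∀ d′ i → 2 * suc d′ * suc i ≡ suc d′ * (2 * suc i)
    reassoc = ℕ-Solver.solve-∀

  F·F⁻¹ : F · fInvT (2 * d) N ≈ 1ₛ
  F·F⁻¹ = ≈-trans (*-congʳ {fInvT (2 * d) N} (≈-sym fT-2d)) (fT·fInvT≈1 (d′ + suc (d′ + 0)))

  private
    N<n : N < n
    N<n = s≤s (ℕ.m≤m+n N (N + 0))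

    2n≡n+n : 2 * n ≡ n + n
    2n≡n+n = cong (λ m → n + m) (ℕ.+-identityʳ n)

    n≤2n : n ≤ 2 * n
    n≤2n = ℕ.m≤m+n n (n + 0)

    small⇒1+k≤N : ∀ k → d * (suc k * suc k) ≤ N → suc k ≤ N
    small⇒1+k≤N k le = ℕ.≤-trans (ℕ.m≤m*n (suc k) (suc k)) (ℕ.≤-trans (ℕ.m≤n*m (suc k * suc k) d) le)

    N+1+k≤n : ∀ k → suc k ≤ N → N + suc k ≤ n
    N+1+k≤n k le = ℕ.≤-trans (ℕ.+-monoʳ-≤ N le) (ℕ.≤-trans (ℕ.+-monoʳ-≤ N (ℕ.≤-reflexive (sym (ℕ.+-identityʳ N)))) (ℕ.n≤1+n _))

  gaussBinom·F : ∀ j → j ≤ 2 * n → N ≤ j → N ≤ 2 * n ∸ j → gaussBinom d (2 * n) j · F ≈ 1ₛ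
  gaussBinom·F j j≤2n N≤j N≤2n∸j = begin
    b · F                                  ≈⟨ solve 2 (λ b f → b :* f := b :* f :* con (+ 1)) ≈-refl b F ⟩
    b · F · 1ₛ                             ≈⟨ *-congˡ {b · F} F·F⁻¹ ⟨
    b · F · (F · F⁻¹)                      ≈⟨ solve 3 (λ b f i → b :* f :* (f :* i) := b :* f :* f :* i) ≈-refl b F F⁻¹ ⟩
    b · F · F · F⁻¹                        ≈⟨ *-congʳ {F⁻¹} (*-cong (*-congˡ {b} (≈-sym (poch-stable N≤j))) (≈-sym (poch-stable N≤2n∸j))) ⟩
    b · poch j · poch (2 * n ∸ j) · F⁻¹    ≈⟨ *-congʳ {F⁻¹} (gaussBinom-poch (2 * n) j j≤2n) ⟩
    poch (2 * n) · F⁻¹                     ≈⟨ *-congʳ {F⁻¹} (poch-stable (ℕ.≤-trans (ℕ.<⇒≤ N<n) n≤2n)) ⟩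
    F · F⁻¹                                ≈⟨ F·F⁻¹ ⟩
    1ₛ                                     ∎
    where
    b = gaussBinom d (2 * n) j
    F⁻¹ = fInvT (2 * d) N

  -- Either the monomial already vanishes modulo q^(N+1), or both indices of the binomial
  -- coefficient are ≥ N, and then F inverts it.
  term·F : ∀ s e j → j ≤ 2 * n → (d * e ≤ N → N ≤ j × N ≤ 2 * n ∸ j) → s · x^ e · gaussBinom d (2 * n) j · F ≈ s · x^ e
  term·F s e j j≤2n small with N ℕ.<? d * e
  ... | yes N<de = begin
    s · x^ e · b · F    ≈⟨ *-congʳ {F} (*-congʳ {b} (*-congˡ {s} (q^-vanish N<de))) ⟩
    s · 0ₛ · b · F      ≈⟨ solve 3 (λ s b f → s :* con (+ 0) :* b :* f := s :* con (+ 0)) ≈-refl s b F ⟩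
    s · 0ₛ              ≈⟨ *-congˡ {s} (q^-vanish N<de) ⟨
    s · x^ e            ∎
    where b = gaussBinom d (2 * n) j
  ... | no N≮de = begin
    s · x^ e · b · F    ≈⟨ solve 4 (λ s x b f → s :* x :* b :* f := s :* x :* (b :* f)) ≈-refl s (x^ e) b F ⟩
    s · x^ e · (b · F)  ≈⟨ *-congˡ {s · x^ e} (gaussBinom·F j j≤2n (proj₁ bounds) (proj₂ bounds)) ⟩
    s · x^ e · 1ₛ       ≈⟨ solve 2 (λ s x → s :* x :* con (+ 1) := s :* x) ≈-refl s (x^ e) ⟩
    s · x^ e            ∎
    where
    b = gaussBinom d (2 * n) j
    bounds = small (ℕ.≮⇒≥ N≮de)

  sgn-∸ : ∀ k → k < n → sgn (n ∸ suc k) ≈ sgn n · sgn (suc k)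
  sgn-∸ k k<n = ≈-sym (begin
    sgn n · sgn (suc k)                            ≈⟨ *-congʳ {sgn (suc k)} (≈-reflexive (cong sgn (sym (ℕ.m∸n+n≡m k<n)))) ⟩
    sgn (n ∸ suc k + suc k) · sgn (suc k)          ≈⟨ *-congʳ {sgn (suc k)} (sgn-+ (n ∸ suc k) (suc k)) ⟩
    sgn (n ∸ suc k) · sgn (suc k) · sgn (suc k)    ≈⟨ solve 2 (λ s t → s :* t :* t := s :* (t :* t)) ≈-refl (sgn (n ∸ suc k)) (sgn (suc k)) ⟩
    sgn (n ∸ suc k) · (sgn (suc k) · sgn (suc k))  ≈⟨ *-congˡ {sgn (n ∸ suc k)} (sgn-square (suc k)) ⟩
    sgn (n ∸ suc k) · 1ₛ                           ≈⟨ solve 1 (λ s → s :* con (+ 1) := s) ≈-refl (sgn (n ∸ suc k)) ⟩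
    sgn (n ∸ suc k)                                ∎)

  regroup-sign : ∀ s k → s ≈ sgn n · sgn (suc k) → s · x^ (suc k * suc k) ≈ sgn n · phiTerm d k
  regroup-sign s k s≈ = ≈-trans (*-congʳ {x^ (suc k * suc k)} s≈)
    (solve 3 (λ a b c → a :* b :* c := a :* (b :* c)) ≈-refl (sgn n) (sgn (suc k)) (x^ (suc k * suc k)))

  below·F : below · F ≈ sgn n · ∑ n (phiTerm d)
  below·F = begin
    below · F                        ≈⟨ ∑-distribʳ n F belowTerm ⟩
    ∑ n (λ k → belowTerm k · F)      ≈⟨ ∑-cong n term ⟩
    ∑ n (λ k → sgn n · phiTerm d k)   ≈⟨ ∑-distribˡ n (sgn n) (phiTerm d) ⟨
    sgn n · ∑ n (phiTerm d)             ∎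
    where
    term : ∀ k → k < n → belowTerm k · F ≈ sgn n · phiTerm d k
    term k k<n = ≈-trans (term·F (sgn (n ∸ suc k)) (suc k * suc k) (n ∸ suc k) (ℕ.≤-trans (ℕ.m∸n≤m n (suc k)) n≤2n) bounds)
                         (regroup-sign (sgn (n ∸ suc k)) k (sgn-∸ k k<n))
      where
      bounds : d * (suc k * suc k) ≤ N → N ≤ n ∸ suc k × N ≤ 2 * n ∸ (n ∸ suc k)
      bounds small = ℕ.m+n≤o⇒m≤o∸n N (N+1+k≤n k (small⇒1+k≤N k small))
                   , ℕ.m+n≤o⇒m≤o∸n N (≡.subst (N + (n ∸ suc k) ≤_) (sym 2n≡n+n) (ℕ.+-mono-≤ (ℕ.<⇒≤ N<n) (ℕ.m∸n≤m n (suc k))))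

  above·F : above · F ≈ sgn n · ∑ n (phiTerm d)
  above·F = begin
    above · F                        ≈⟨ ∑-distribʳ n F aboveTerm ⟩
    ∑ n (λ k → aboveTerm k · F)      ≈⟨ ∑-cong n term ⟩
    ∑ n (λ k → sgn n · phiTerm d k)   ≈⟨ ∑-distribˡ n (sgn n) (phiTerm d) ⟨
    sgn n · ∑ n (phiTerm d)             ∎
    where
    term : ∀ k → k < n → aboveTerm k · F ≈ sgn n · phiTerm d k
    term k k<n = ≈-trans (term·F (sgn (n + suc k)) (suc k * suc k) (n + suc k) n+1+k≤2n bounds)
                         (regroup-sign (sgn (n + suc k)) k (sgn-+ n (suc k)))
      where
      n+1+k≤2n : n + suc k ≤ 2 * n
      n+1+k≤2n = ≡.subst (n + suc k ≤_) (sym 2n≡n+n) (ℕ.+-monoʳ-≤ n k<n)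
      swap : ∀ x y z → y + (x + z) ≡ x + (y + z)
      swap = ℕ-Solver.solve-∀
      bounds : d * (suc k * suc k) ≤ N → N ≤ n + suc k × N ≤ 2 * n ∸ (n + suc k)
      bounds small = ℕ.≤-trans (ℕ.<⇒≤ N<n) (ℕ.m≤m+n n (suc k))
                   , ℕ.m+n≤o⇒m≤o∸n N (≡.subst (N + (n + suc k) ≤_) (sym 2n≡n+n)
                       (≡.subst (_≤ n + n) (swap N n (suc k)) (ℕ.+-monoʳ-≤ n (N+1+k≤n k (small⇒1+k≤N k small)))))

  middle·F : middle · F ≈ sgn n · 1ₛ
  middle·F = ≈-trans (term·F (sgn n) 0 n n≤2n (λ _ → ℕ.<⇒≤ N<n , ℕ.m+n≤o⇒m≤o∸n N (≡.subst (N + n ≤_) (sym 2n≡n+n) (ℕ.+-monoˡ-≤ n (ℕ.<⇒≤ N<n)))))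
                     (*-congˡ {sgn n} x^0)

  ∑phiTerm≈phiTail : ∑ n (phiTerm d) ≈ phiTail d N
  ∑phiTerm≈phiTail = ∑-extend (phiTerm d) N<n (λ k 1+N≤k →
    ≈-trans (*-congˡ {sgn (suc k)} (x^-vanish (ℕ.<-≤-trans 1+N≤k (ℕ.≤-trans (ℕ.n≤1+n k) (ℕ.m≤m*n (suc k) (suc k))))))
            (solve 1 (λ s → s :* con (+ 0) := con (+ 0)) ≈-refl (sgn (suc k))))

  symmetricSum·F : symmetricSum · F ≈ sgn n · phi d N
  symmetricSum·F = begin
    (below ⊕ middle ⊕ above) · F                       ≈⟨ solve 4 (λ x y z f → (x :+ y :+ z) :* f := x :* f :+ y :* f :+ z :* f) ≈-refl below middle above F ⟩
    below · F ⊕ middle · F ⊕ above · F                 ≈⟨ +-cong (+-cong below·F middle·F) above·F ⟩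
    sgn n · A ⊕ sgn n · 1ₛ ⊕ sgn n · A
      ≈⟨ solve 2 (λ s x → s :* x :+ s :* con (+ 1) :+ s :* x := s :* (con (+ 1) :+ con (+ 2) :* x)) ≈-refl (sgn n) A ⟩
    sgn n · (1ₛ ⊕ cst (+ 2) · A)                       ≈⟨ *-congˡ {sgn n} (+-congˡ {1ₛ} (*-congˡ {cst (+ 2)} ∑phiTerm≈phiTail)) ⟩
    sgn n · phi d N                                    ∎
    where A = ∑ n (phiTerm d)

  symmetricSum≈ : symmetricSum ≈ sgn n · oddPoch · oddPoch
  symmetricSum≈ = q^-cancel (d * tripleProductExponent n) N (TripleProduct.symmetricSum-shifted (d * tripleProductExponent n + N) d (2 * N))

  phi≈ : phi d N ≈ oddPoch · oddPoch · F
  phi≈ = begin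
    phi d N                                  ≈⟨ solve 1 (λ t → t := con (+ 1) :* t) ≈-refl (phi d N) ⟩
    1ₛ · phi d N                             ≈⟨ *-congʳ {phi d N} (sgn-square n) ⟨
    sgn n · sgn n · phi d N                  ≈⟨ solve 2 (λ s t → s :* s :* t := s :* (s :* t)) ≈-refl (sgn n) (phi d N) ⟩
    sgn n · (sgn n · phi d N)                ≈⟨ *-congˡ {sgn n} symmetricSum·F ⟨
    sgn n · (symmetricSum · F)               ≈⟨ *-congˡ {sgn n} (*-congʳ {F} symmetricSum≈) ⟩
    sgn n · (sgn n · oddPoch · oddPoch · F)  ≈⟨ solve 3 (λ s o f → s :* (s :* o :* o :* f) := s :* s :* (o :* o :* f)) ≈-refl (sgn n) oddPoch F ⟩
    sgn n · sgn n · (oddPoch · oddPoch · F)  ≈⟨ *-congʳ {oddPoch · oddPoch · F} (sgn-square n) ⟩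
    1ₛ · (oddPoch · oddPoch · F)             ≈⟨ solve 1 (λ t → con (+ 1) :* t := t) ≈-refl (oddPoch · oddPoch · F) ⟩
    oddPoch · oddPoch · F                    ∎

  oddPoch·F : oddPoch · F ≈ fT d N
  oddPoch·F = begin
    oddPoch · F                                              ≈⟨ *-congˡ {oddPoch} (poch-stable (ℕ.<⇒≤ N<n)) ⟨
    ∏ n odd · poch n                                         ≈⟨ ∏-merge n odd (λ i → 1ₛ ⊕ ⊝ x^ (2 * suc i)) ⟨
    ∏ n (λ i → odd i · (1ₛ ⊕ ⊝ x^ (2 * suc i)))             ≈⟨ ∏-cong n (λ i _ → ≈-trans (*-cong (+-congˡ {1ₛ} (-‿cong (x^-cong (cong suc (even i)))))
                                                                                                 (+-congˡ {1ₛ} (-‿cong (x^-cong (odd′ i)))))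
                                                                  (solve 2 (λ a b → a :* b := a :* (b :* con (+ 1))) ≈-refl (factor (i * 2 + 0)) (factor (i * 2 + 1)))) ⟩
    ∏ n (λ i → ∏ 2 (λ j → factor (i * 2 + j)))               ≈⟨ ∏-blocks n 2 factor ⟨
    ∏ (n * 2) factor                                         ≈⟨ ∏-extend factor (ℕ.≤-trans (ℕ.<⇒≤ N<n) (ℕ.m≤m*n n 2)) (λ i N≤i →
                                                                  ≈-trans (+-congˡ {1ₛ} (-‿cong (x^-vanish (s≤s N≤i))))
                                                                          (solve 0 (con (+ 1) :+ :- con (+ 0) := con (+ 1)) ≈-refl)) ⟩
    ∏ N factor                                               ≈⟨ fT-d ⟨
    fT d N                                                   ∎
    where
    factor : ℕ → Series
    factor i = 1ₛ ⊕ ⊝ x^ suc i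
    even : ∀ i → 2 * i ≡ i * 2 + 0
    even = ℕ-Solver.solve-∀
    odd′ : ∀ i → 2 * suc i ≡ suc (i * 2 + 1)
    odd′ = ℕ-Solver.solve-∀

  gauss : phi d N · fT (2 * d) N ≈ fT d N · fT d N
  gauss = begin
    phi d N · fT (2 * d) N               ≈⟨ *-cong phi≈ fT-2d ⟩
    oddPoch · oddPoch · F · F            ≈⟨ solve 2 (λ o f → o :* o :* f :* f := (o :* f) :* (o :* f)) ≈-refl oddPoch F ⟩
    (oddPoch · F) · (oddPoch · F)        ≈⟨ *-cong oddPoch·F oddPoch·F ⟩
    fT d N · fT d N                      ∎

-- The 3-dissection of φ(−q) and the generating function modulo 32

-- W(q) = ∑_j (−1)^j (q^(3j²+2j) − q^(3j²+4j+1)), with q replaced by q^c; then φ(−q) = φ(−q⁹) − 2q W(q³).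
wTerm : ℕ → ℕ → Series
wTerm c j = sgn j · q^ (c * (3 * j * j + 2 * j)) ⊕ ⊝ (sgn j · q^ (c * (3 * j * j + 4 * j + 1)))

W : ℕ → ℕ → Series
W c N = ∑ (suc N) (wTerm c)

module Dissection (N d′ : ℕ) where
  d : ℕ
  d = suc d′

  open Truncated N
  open ≈-Reasoning
  open Signs N

  sgn-*3 : ∀ i → sgn (i * 3) ≈ sgn i
  sgn-*3 zero    = ≈-refl
  sgn-*3 (suc i) = begin
    sgn (3 + i * 3)           ≈⟨ ≈-trans (sgn-suc (2 + i * 3)) (-‿cong (≈-trans (sgn-suc (1 + i * 3)) (-‿cong (sgn-suc (i * 3))))) ⟩
    ⊝ ⊝ ⊝ sgn (i * 3)         ≈⟨ -‿cong (-‿cong (-‿cong (sgn-*3 i))) ⟩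
    ⊝ ⊝ ⊝ sgn i               ≈⟨ solve 1 (λ s → :- :- :- s := :- s) ≈-refl (sgn i) ⟩
    ⊝ sgn i                   ≈⟨ sgn-suc i ⟨
    sgn (suc i)               ∎

  phiTail-dissection : phiTail d N ≈ phiTail (9 * d) N ⊕ ⊝ (q^ d · W (3 * d) N)
  phiTail-dissection = begin
    ∑ K (phiTerm d)                                                   ≈⟨ ∑-extend (phiTerm d) (ℕ.m≤m*n K 3) vanish ⟨
    ∑ (K * 3) (phiTerm d)                                             ≈⟨ ∑-blocks K 3 (phiTerm d) ⟩
    ∑ K (λ i → ∑ 3 (λ j → phiTerm d (i * 3 + j)))                     ≈⟨ ∑-cong K (λ i _ → residues i) ⟩
    ∑ K (λ i → phiTerm (9 * d) i ⊕ ⊝ (q^ d · wTerm (3 * d) i))        ≈⟨ ∑-merge K (phiTerm (9 * d)) (λ i → ⊝ (q^ d · wTerm (3 * d) i)) ⟩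
    ∑ K (phiTerm (9 * d)) ⊕ ∑ K (λ i → ⊝ (q^ d · wTerm (3 * d) i))
      ≈⟨ +-congˡ {∑ K (phiTerm (9 * d))} (≈-sym (≈-trans (-‿cong (∑-distribˡ K (q^ d) (wTerm (3 * d)))) (∑-neg K (λ i → q^ d · wTerm (3 * d) i)))) ⟩
    ∑ K (phiTerm (9 * d)) ⊕ ⊝ (q^ d · W (3 * d) N)                    ∎
    where
    K = suc N
    vanish : ∀ k → K ≤ k → phiTerm d k ≈ 0ₛ
    vanish k K≤k = ≈-trans (*-congˡ {sgn (suc k)} (q^-vanish (ℕ.<-≤-trans K≤k (ℕ.≤-trans (ℕ.n≤1+n k)
                     (ℕ.≤-trans (ℕ.m≤m*n (suc k) (suc k)) (ℕ.m≤n*m (suc k * suc k) d))))))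
                   (solve 1 (λ s → s :* con (+ 0) := con (+ 0)) ≈-refl (sgn (suc k)))
    exponent₀ : ∀ d i → d * (suc (i * 3 + 0) * suc (i * 3 + 0)) ≡ d + 3 * d * (3 * i * i + 2 * i)
    exponent₀ = ℕ-Solver.solve-∀
    exponent₁ : ∀ d i → d * (suc (i * 3 + 1) * suc (i * 3 + 1)) ≡ d + 3 * d * (3 * i * i + 4 * i + 1)
    exponent₁ = ℕ-Solver.solve-∀
    exponent₂ : ∀ d i → d * (suc (i * 3 + 2) * suc (i * 3 + 2)) ≡ 9 * d * (suc i * suc i)
    exponent₂ = ℕ-Solver.solve-∀
    sgn-residue : ∀ i j → sgn (suc (i * 3 + j)) ≈ sgn i · sgn (suc j)
    sgn-residue i j = ≈-trans (≈-reflexive (cong sgn (sym (ℕ.+-suc (i * 3) j)))) (≈-trans (sgn-+ (i * 3) (suc j)) (*-congʳ {sgn (suc j)} (sgn-*3 i)))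
    residues : ∀ i → ∑ 3 (λ j → phiTerm d (i * 3 + j)) ≈ phiTerm (9 * d) i ⊕ ⊝ (q^ d · wTerm (3 * d) i)
    residues i = begin
      phiTerm d (i * 3 + 0) ⊕ (phiTerm d (i * 3 + 1) ⊕ (phiTerm d (i * 3 + 2) ⊕ 0ₛ))
        ≈⟨ +-cong (*-cong (sgn-residue i 0) (≈-trans (≈-reflexive (cong q^_ (exponent₀ d i))) (≈-sym (≗⇒≈ (q^-+ d _)))))
                  (+-cong (*-cong (sgn-residue i 1) (≈-trans (≈-reflexive (cong q^_ (exponent₁ d i))) (≈-sym (≗⇒≈ (q^-+ d _)))))
                          (+-congʳ {0ₛ} (*-cong (≈-trans (sgn-residue i 2) (solve 1 (λ s → s :* con -1ℤ := :- s) ≈-refl (sgn i)))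
                                                (≈-reflexive (cong q^_ (exponent₂ d i)))))) ⟩
      sgn i · sgn 1 · (q^ d · A) ⊕ (sgn i · sgn 2 · (q^ d · B) ⊕ (⊝ sgn i · q^ (9 * d * (suc i * suc i)) ⊕ 0ₛ))
        ≈⟨ +-congˡ {sgn i · sgn 1 · (q^ d · A)} (+-congˡ {sgn i · sgn 2 · (q^ d · B)} (+-congʳ {0ₛ} (*-congʳ {q^ (9 * d * (suc i * suc i))} (sgn-suc i)))) ⟨
      sgn i · sgn 1 · (q^ d · A) ⊕ (sgn i · sgn 2 · (q^ d · B) ⊕ (phiTerm (9 * d) i ⊕ 0ₛ))
        ≈⟨ solve 5 (λ s x a b t → s :* con -1ℤ :* (x :* a) :+ (s :* con (+ 1) :* (x :* b) :+ (t :+ con (+ 0)))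
                                   := t :+ :- (x :* (s :* a :+ :- (s :* b)))) ≈-refl (sgn i) (q^ d) A B (phiTerm (9 * d) i) ⟩
      phiTerm (9 * d) i ⊕ ⊝ (q^ d · wTerm (3 * d) i)
        ∎
      where
      A = q^ (3 * d * (3 * i * i + 2 * i))
      B = q^ (3 * d * (3 * i * i + 4 * i + 1))

module Frobenius (N : ℕ) where
  open Truncated N
  open Signs N
  open mod-Reasoning (cst (+ 2))

  2≈1+1 : cst (+ 2) ≈ 1ₛ ⊕ 1ₛ
  2≈1+1 = solve 0 (con (+ 2) := con (+ 1) :+ con (+ 1)) ≈-refl

  sgn≡1 : ∀ j → sgn j ≡ 1ₛ [mod cst (+ 2) ]
  sgn≡1 zero    = ≈⇒≡mod ≈-refl
  sgn≡1 (suc j) = begin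
    sgn (suc j)   ≈⟨ ≈⇒≡mod (sgn-suc j) ⟩
    ⊝ sgn j       ≈⟨ mod-neg-cong (sgn≡1 j) ⟩
    ⊝ 1ₛ          ≈⟨ ⊝ 1ₛ , solve 0 (:- con (+ 1) := con (+ 1) :+ con (+ 2) :* :- con (+ 1)) ≈-refl ⟩
    1ₛ            ∎

  q^-square : ∀ c e → q^ (c * e) · q^ (c * e) ≈ q^ (2 * c * e)
  q^-square c e = ≈-trans (≗⇒≈ (q^-+ (c * e) (c * e))) (≈-reflexive (cong q^_ (double c e)))
    where
    double : ∀ c e → c * e + c * e ≡ 2 * c * e
    double = ℕ-Solver.solve-∀

  signed-square : ∀ j x → (sgn j · x) · (sgn j · x) ≡ sgn j · (x · x) [mod cst (+ 2) ]
  signed-square j x = begin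
    (sgn j · x) · (sgn j · x)   ≈⟨ ≈⇒≡mod (solve 2 (λ s x → (s :* x) :* (s :* x) := (s :* s) :* (x :* x)) ≈-refl (sgn j) x) ⟩
    (sgn j · sgn j) · (x · x)   ≈⟨ ≈⇒≡mod (*-congʳ {x · x} (sgn-square j)) ⟩
    1ₛ · (x · x)                ≈⟨ mod-*-cong (mod-sym (sgn≡1 j)) (≈⇒≡mod ≈-refl) ⟩
    sgn j · (x · x)             ∎

  phiTerm-square : ∀ c k → phiTerm c k · phiTerm c k ≡ phiTerm (2 * c) k [mod cst (+ 2) ]
  phiTerm-square c k = mod-trans (signed-square (suc k) (q^ (c * (suc k * suc k))))
    (≈⇒≡mod (*-congˡ {sgn (suc k)} (q^-square c (suc k * suc k))))

  wTerm-square : ∀ c j → wTerm c j · wTerm c j ≡ wTerm (2 * c) j [mod cst (+ 2) ]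
  wTerm-square c j = begin
    (s · x ⊕ ⊝ (s · y)) · (s · x ⊕ ⊝ (s · y))                     ≈⟨ ≈⇒≡mod (solve 3 (λ s x y → (s :* x :+ :- (s :* y)) :* (s :* x :+ :- (s :* y))
                                                                       := (s :* s) :* (x :* x :+ :- (y :* y)) :+ con (+ 2) :* ((s :* s) :* (y :* y :+ :- (x :* y)))) ≈-refl s x y) ⟩
    (s · s) · (x · x ⊕ ⊝ (y · y)) ⊕ cst (+ 2) · ((s · s) · (y · y ⊕ ⊝ (x · y)))
                                                                  ≈⟨ (s · s) · (y · y ⊕ ⊝ (x · y)) , ≈-refl ⟩
    (s · s) · (x · x ⊕ ⊝ (y · y))                                 ≈⟨ ≈⇒≡mod (*-congʳ {x · x ⊕ ⊝ (y · y)} (sgn-square j)) ⟩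
    1ₛ · (x · x ⊕ ⊝ (y · y))                                      ≈⟨ mod-*-cong (mod-sym (sgn≡1 j)) (≈⇒≡mod (+-cong (q^-square c _) (-‿cong (q^-square c _)))) ⟩
    s · (q^ (2 * c * e₁) ⊕ ⊝ q^ (2 * c * e₂))
      ≈⟨ ≈⇒≡mod (solve 3 (λ s a b → s :* (a :+ :- b) := s :* a :+ :- (s :* b)) ≈-refl s (q^ (2 * c * e₁)) (q^ (2 * c * e₂))) ⟩
    wTerm (2 * c) j                                               ∎
    where
    s = sgn j
    e₁ = 3 * j * j + 2 * j
    e₂ = 3 * j * j + 4 * j + 1
    x = q^ (c * e₁)
    y = q^ (c * e₂)

  phiTail-square : ∀ c → phiTail c N · phiTail c N ≡ phiTail (2 * c) N [mod cst (+ 2) ]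
  phiTail-square c = mod-trans (square-∑≡∑-square 2≈1+1 (suc N) (phiTerm c)) (mod-∑-cong (suc N) (λ k _ → phiTerm-square c k))

  W-square : ∀ c → W c N · W c N ≡ W (2 * c) N [mod cst (+ 2) ]
  W-square c = mod-trans (square-∑≡∑-square 2≈1+1 (suc N) (wTerm c)) (mod-∑-cong (suc N) (λ j _ → wTerm-square c j))

module GeneratingFunction (N : ℕ) where
  open Truncated N
  open ≈-Reasoning

  -- 1/φ(−q^d) = f_{2d} / f_d².
  recipPhi : ℕ → Series
  recipPhi d = fT (2 * d) N · fInvT d N · fInvT d N

  phi-products : ∀ d′ → phi (suc d′) N ≈ fT (suc d′) N · fT (suc d′) N · fInvT (2 * suc d′) N
  phi-products d′ = begin
    phi d N                                    ≈⟨ solve 1 (λ t → t := t :* con (+ 1)) ≈-refl (phi d N) ⟩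
    phi d N · 1ₛ                               ≈⟨ *-congˡ {phi d N} (fT·fInvT≈1 (d′ + suc (d′ + 0))) ⟨
    phi d N · (fT (2 * d) N · fInvT (2 * d) N) ≈⟨ solve 3 (λ t f i → t :* (f :* i) := (t :* f) :* i) ≈-refl (phi d N) (fT (2 * d) N) (fInvT (2 * d) N) ⟩
    phi d N · fT (2 * d) N · fInvT (2 * d) N   ≈⟨ *-congʳ {fInvT (2 * d) N} (GaussIdentity.gauss N d′) ⟩
    fT d N · fT d N · fInvT (2 * d) N          ∎
    where d = suc d′

  phi·recipPhi : ∀ d′ → phi (suc d′) N · recipPhi (suc d′) ≈ 1ₛ
  phi·recipPhi d′ = begin
    phi d N · (fT (2 * d) N · fInvT d N · fInvT d N)
      ≈⟨ solve 4 (λ t f i j → t :* (f :* i :* j) := (t :* f) :* i :* j) ≈-refl (phi d N) (fT (2 * d) N) (fInvT d N) (fInvT d N) ⟩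
    phi d N · fT (2 * d) N · fInvT d N · fInvT d N    ≈⟨ *-congʳ {fInvT d N} (*-congʳ {fInvT d N} (GaussIdentity.gauss N d′)) ⟩
    fT d N · fT d N · fInvT d N · fInvT d N           ≈⟨ solve 2 (λ f i → f :* f :* i :* i := (f :* i) :* (f :* i)) ≈-refl (fT d N) (fInvT d N) ⟩
    (fT d N · fInvT d N) · (fT d N · fInvT d N)       ≈⟨ *-cong (fT·fInvT≈1 d′) (fT·fInvT≈1 d′) ⟩
    1ₛ · 1ₛ                                           ≈⟨ solve 0 (con (+ 1) :* con (+ 1) := con (+ 1)) ≈-refl ⟩
    1ₛ                                                ∎
    where d = suc d′

  ^S≈ : ∀ s k → s ^S k ≈ s ^ k
  ^S≈ s zero    = ≗⇒≈ (λ { zero → refl ; (suc _) → refl })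
  ^S≈ s (suc k) = *-congˡ {s} (^S≈ s k)

  genS9≈phi-quotient : genS9 N ≈ phi 2 N · phi 9 N · recipPhi 1 · recipPhi 18
  genS9≈phi-quotient = begin
    genS9 N
      ≈⟨ *-cong (*-cong (*-cong (*-cong (*-cong (^S≈ f₂ 3) (^S≈ f₉ 2)) ≈-refl) (^S≈ i₁ 2)) ≈-refl) (^S≈ i₁₈ 3) ⟩
    f₂ ^ 3 · f₉ ^ 2 · f₃₆ · i₁ ^ 2 · i₄ · i₁₈ ^ 3
      ≈⟨ CM.prove 6 ((a ⊗ (a ⊗ (a ⊗ CM.id))) ⊗ (b ⊗ (b ⊗ CM.id)) ⊗ c ⊗ (x ⊗ (x ⊗ CM.id)) ⊗ y ⊗ (z ⊗ (z ⊗ (z ⊗ CM.id))))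
                                                                                   ((a ⊗ a ⊗ y) ⊗ (b ⊗ b ⊗ z) ⊗ (a ⊗ x ⊗ x) ⊗ (c ⊗ z ⊗ z)) (f₂ ∷ f₉ ∷ f₃₆ ∷ i₁ ∷ i₄ ∷ i₁₈ ∷ []) ⟩
    (f₂ · f₂ · i₄) · (f₉ · f₉ · i₁₈) · recipPhi 1 · recipPhi 18
      ≈⟨ *-congʳ {recipPhi 18} (*-congʳ {recipPhi 1} (*-cong (≈-sym (phi-products 1)) (≈-sym (phi-products 8)))) ⟩
    phi 2 N · phi 9 N · recipPhi 1 · recipPhi 18                        ∎
    where
    module CM = CommutativeMonoidSolver *-commutativeMonoid
    infixl 7 _⊗_
    _⊗_ : CM.Expr 6 → CM.Expr 6 → CM.Expr 6
    _⊗_ = CM._⊕_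
    a b c x y z : CM.Expr 6
    a = CM.var (# 0)
    b = CM.var (# 1)
    c = CM.var (# 2)
    x = CM.var (# 3)
    y = CM.var (# 4)
    z = CM.var (# 5)
    f₂ = fT 2 N
    f₉ = fT 9 N
    f₃₆ = fT 36 N
    i₁ = fInvT 1 N
    i₄ = fInvT 4 N
    i₁₈ = fInvT 18 N

  phi-dissection : ∀ d′ → phi (suc d′) N ≈ phi (9 * suc d′) N ⊕ ⊝ (cst (+ 2) · (q^ suc d′ · W (3 * suc d′) N))
  phi-dissection d′ = begin
    1ₛ ⊕ cst (+ 2) · phiTail (suc d′) N                   ≈⟨ +-congˡ {1ₛ} (*-congˡ {cst (+ 2)} (Dissection.phiTail-dissection N d′)) ⟩
    1ₛ ⊕ cst (+ 2) · (A ⊕ ⊝ (q^ suc d′ · Y))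
      ≈⟨ solve 3 (λ a x y → con (+ 1) :+ con (+ 2) :* (a :+ :- (x :* y)) := (con (+ 1) :+ con (+ 2) :* a) :+ :- (con (+ 2) :* (x :* y))) ≈-refl A (q^ suc d′) Y ⟩
    phi (9 * suc d′) N ⊕ ⊝ (cst (+ 2) · (q^ suc d′ · Y))  ∎
    where
    A = phiTail (9 * suc d′) N
    Y = W (3 * suc d′) N

  u v w : Series
  u = q^ 1 · W 3 N · recipPhi 9
  v = q^ 2 · W 6 N · recipPhi 18
  w = phi 9 N · recipPhi 1

  phi2·recipPhi18 : phi 2 N · recipPhi 18 ≈ 1ₛ ⊕ ⊝ (cst (+ 2) · v)
  phi2·recipPhi18 = begin
    phi 2 N · recipPhi 18                                       ≈⟨ *-congʳ {recipPhi 18} (phi-dissection 1) ⟩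
    (phi 18 N ⊕ ⊝ (cst (+ 2) · (q^ 2 · W 6 N))) · recipPhi 18
      ≈⟨ solve 4 (λ t x y s → (t :+ :- (con (+ 2) :* (x :* y))) :* s := t :* s :+ :- (con (+ 2) :* (x :* y :* s))) ≈-refl
                                                                     (phi 18 N) (q^ 2) (W 6 N) (recipPhi 18) ⟩
    phi 18 N · recipPhi 18 ⊕ ⊝ (cst (+ 2) · v)                  ≈⟨ +-congʳ {⊝ (cst (+ 2) · v)} (phi·recipPhi 17) ⟩
    1ₛ ⊕ ⊝ (cst (+ 2) · v)                                      ∎

  w·[1-2u] : w · (1ₛ ⊕ ⊝ (cst (+ 2) · u)) ≈ 1ₛ
  w·[1-2u] = begin
    phi 9 N · recipPhi 1 · (1ₛ ⊕ ⊝ (cst (+ 2) · (q^ 1 · W 3 N · recipPhi 9)))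
      ≈⟨ solve 5 (λ t s x y r → t :* s :* (con (+ 1) :+ :- (con (+ 2) :* (x :* y :* r))) := s :* (t :+ :- (con (+ 2) :* (x :* y) :* (t :* r)))) ≈-refl
           (phi 9 N) (recipPhi 1) (q^ 1) (W 3 N) (recipPhi 9) ⟩
    recipPhi 1 · (phi 9 N ⊕ ⊝ (cst (+ 2) · (q^ 1 · W 3 N) · (phi 9 N · recipPhi 9)))
      ≈⟨ *-congˡ {recipPhi 1} (+-congˡ {phi 9 N} (-‿cong (*-congˡ {cst (+ 2) · (q^ 1 · W 3 N)} (phi·recipPhi 8)))) ⟩
    recipPhi 1 · (phi 9 N ⊕ ⊝ (cst (+ 2) · (q^ 1 · W 3 N) · 1ₛ))
      ≈⟨ solve 4 (λ s t x y → s :* (t :+ :- (con (+ 2) :* (x :* y) :* con (+ 1))) := (t :+ :- (con (+ 2) :* (x :* y))) :* s) ≈-refl (recipPhi 1) (phi 9 N) (q^ 1) (W 3 N) ⟩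
    (phi 9 N ⊕ ⊝ (cst (+ 2) · (q^ 1 · W 3 N))) · recipPhi 1
      ≈⟨ *-congʳ {recipPhi 1} (phi-dissection 0) ⟨
    phi 1 N · recipPhi 1
      ≈⟨ phi·recipPhi 0 ⟩
    1ₛ ∎

  genS9≈[1-2v]w : genS9 N ≈ (1ₛ ⊕ ⊝ (cst (+ 2) · v)) · w
  genS9≈[1-2v]w = begin
    genS9 N                                         ≈⟨ genS9≈phi-quotient ⟩
    phi 2 N · phi 9 N · recipPhi 1 · recipPhi 18
      ≈⟨ solve 4 (λ a b c d → a :* b :* c :* d := (a :* d) :* (b :* c)) ≈-refl (phi 2 N) (phi 9 N) (recipPhi 1) (recipPhi 18) ⟩
    (phi 2 N · recipPhi 18) · w                     ≈⟨ *-congʳ {w} phi2·recipPhi18 ⟩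
    (1ₛ ⊕ ⊝ (cst (+ 2) · v)) · w                    ∎

module Congruences (N : ℕ) where
  open Truncated N
  open GeneratingFunction N
  open Frobenius N using (W-square; phiTail-square)

  geometric : Series
  geometric = 1ₛ ⊕ cst (+ 2) · u ⊕ cst (+ 4) · (u · u) ⊕ cst (+ 8) · (u · u · u) ⊕ cst (+ 16) · (u · u · u · u)

  w≡geometric : w ≡ geometric [mod cst (+ 32) ]
  w≡geometric = u · u · u · u · u · w , (begin
    w                                                                ≈⟨ solve 2 (λ w u → w := w :* (con (+ 1) :+ :- (con (+ 2) :* u))
                                                                          :* (con (+ 1) :+ con (+ 2) :* u :+ con (+ 4) :* (u :* u) :+ con (+ 8) :* (u :* u :* u) :+ con (+ 16) :* (u :* u :* u :* u))
                                                                          :+ con (+ 32) :* (u :* u :* u :* u :* u :* w)) ≈-refl w u ⟩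
    w · (1ₛ ⊕ ⊝ (cst (+ 2) · u)) · geometric ⊕ cst (+ 32) · r        ≈⟨ +-congʳ {cst (+ 32) · r} (*-congʳ {geometric} w·[1-2u]) ⟩
    1ₛ · geometric ⊕ cst (+ 32) · r                                  ≈⟨ +-congʳ {cst (+ 32) · r} (solve 1 (λ p → con (+ 1) :* p := p) ≈-refl geometric) ⟩
    geometric ⊕ cst (+ 32) · r                                       ∎)
    where
    open ≈-Reasoning
    r = u · u · u · u · u · w

  R : Series
  R = 1ₛ ⊕ cst (+ 2) · u ⊕ cst (+ 8) · (u · u · u) ⊕ cst (+ 16) · (u · u · u · u)
      ⊕ ⊝ (cst (+ 2) · v) ⊕ ⊝ (cst (+ 4) · (u · v)) ⊕ ⊝ (cst (+ 8) · (u · u · v))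

  genS9≡[mod32] : genS9 N ≡ R ⊕ cst (+ 4) · (u · u) ⊕ ⊝ (cst (+ 16) · (u · u · u · v)) [mod cst (+ 32) ]
  genS9≡[mod32] = begin
    genS9 N                                       ≈⟨ ≈⇒≡mod genS9≈[1-2v]w ⟩
    (1ₛ ⊕ ⊝ (cst (+ 2) · v)) · w                  ≈⟨ mod-*-congˡ (1ₛ ⊕ ⊝ (cst (+ 2) · v)) w≡geometric ⟩
    (1ₛ ⊕ ⊝ (cst (+ 2) · v)) · geometric          ≈⟨ ⊝ (u · u · u · u · v) , expand ⟩
    R ⊕ cst (+ 4) · (u · u) ⊕ ⊝ (cst (+ 16) · (u · u · u · v)) ∎
    where
    open mod-Reasoning (cst (+ 32))
    expand : (1ₛ ⊕ ⊝ (cst (+ 2) · v)) · geometric ≈ R ⊕ cst (+ 4) · (u · u) ⊕ ⊝ (cst (+ 16) · (u · u · u · v)) ⊕ cst (+ 32) · ⊝ (u · u · u · u · v)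
    expand = solve 2 (λ u v → (con (+ 1) :+ :- (con (+ 2) :* v))
                                :* (con (+ 1) :+ con (+ 2) :* u :+ con (+ 4) :* (u :* u) :+ con (+ 8) :* (u :* u :* u) :+ con (+ 16) :* (u :* u :* u :* u))
                              := (con (+ 1) :+ con (+ 2) :* u :+ con (+ 8) :* (u :* u :* u) :+ con (+ 16) :* (u :* u :* u :* u)
                                  :+ :- (con (+ 2) :* v) :+ :- (con (+ 4) :* (u :* v)) :+ :- (con (+ 8) :* (u :* u :* v)))
                                 :+ con (+ 4) :* (u :* u) :+ :- (con (+ 16) :* (u :* u :* u :* v)) :+ con (+ 32) :* :- (u :* u :* u :* u :* v))
                     ≈-refl u v

  recipPhi≡1[mod2] : ∀ d′ → recipPhi (suc d′) ≡ 1ₛ [mod cst (+ 2) ]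
  recipPhi≡1[mod2] d′ = ⊝ (A · s) , (begin
    s                                     ≈⟨ solve 2 (λ s a → s := (con (+ 1) :+ con (+ 2) :* a) :* s :+ con (+ 2) :* :- (a :* s)) ≈-refl s A ⟩
    phi (suc d′) N · s ⊕ cst (+ 2) · ⊝ (A · s)
                                          ≈⟨ +-congʳ {cst (+ 2) · ⊝ (A · s)} (phi·recipPhi d′) ⟩
    1ₛ ⊕ cst (+ 2) · ⊝ (A · s)            ∎)
    where
    open ≈-Reasoning
    s = recipPhi (suc d′)
    A = phiTail (suc d′) N

  recipPhi≡[mod8] : ∀ d′ → recipPhi (suc d′) ≡ 1ₛ ⊕ ⊝ (cst (+ 2) · phiTail (suc d′) N) ⊕ cst (+ 4) · (phiTail (suc d′) N · phiTail (suc d′) N) [mod cst (+ 8) ]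
  recipPhi≡[mod8] d′ = ⊝ (A · A · A · s) , (begin
    s                                     ≈⟨ solve 2 (λ s a → s := (con (+ 1) :+ con (+ 2) :* a) :* s :* (con (+ 1) :+ :- (con (+ 2) :* a) :+ con (+ 4) :* (a :* a))
                                                                  :+ con (+ 8) :* :- (a :* a :* a :* s)) ≈-refl s A ⟩
    phi (suc d′) N · s · Q ⊕ cst (+ 8) · ⊝ (A · A · A · s)
                                          ≈⟨ +-congʳ {cst (+ 8) · ⊝ (A · A · A · s)} (*-congʳ {Q} (phi·recipPhi d′)) ⟩
    1ₛ · Q ⊕ cst (+ 8) · ⊝ (A · A · A · s)
                                          ≈⟨ +-congʳ {cst (+ 8) · ⊝ (A · A · A · s)} (solve 1 (λ q → con (+ 1) :* q := q) ≈-refl Q) ⟩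
    Q ⊕ cst (+ 8) · ⊝ (A · A · A · s)     ∎)
    where
    open ≈-Reasoning
    s = recipPhi (suc d′)
    A = phiTail (suc d′) N
    Q = 1ₛ ⊕ ⊝ (cst (+ 2) · A) ⊕ cst (+ 4) · (A · A)

  X₂ X₃ : Series
  X₂ = q^ 2 · W 3 N · W 3 N ⊕ ⊝ (cst (+ 4) · (q^ 2 · W 3 N · W 3 N · phiTail 9 N)) ⊕ cst (+ 4) · (q^ 2 · W 6 N · phiTail 18 N)
  X₃ = q^ 5 · W 3 N · W 6 N · W 6 N

  u²≡X₂ : u · u ≡ X₂ [mod cst (+ 8) ]
  u²≡X₂ = begin
    u · u
      ≈⟨ ≈⇒≡mod (solve 3 (λ x y s → (x :* y :* s) :* (x :* y :* s) := (x :* x) :* (y :* y) :* (s :* s)) ≈-refl (q^ 1) Y₃ s₉) ⟩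
    (q^ 1 · q^ 1) · (Y₃ · Y₃) · (s₉ · s₉)
      ≈⟨ mod-*-cong (≈⇒≡mod (*-congʳ {Y₃ · Y₃} (≗⇒≈ (q^-+ 1 1)))) (mod-*-cong (recipPhi≡[mod8] 8) (recipPhi≡[mod8] 8)) ⟩
    q^ 2 · (Y₃ · Y₃) · (Q · Q)                      ≈⟨ mod-*-congˡ (q^ 2 · (Y₃ · Y₃)) Q²≡ ⟩
    q^ 2 · (Y₃ · Y₃) · (1ₛ ⊕ ⊝ (cst (+ 4) · A) ⊕ cst (+ 4) · (A · A))
                                                    ≈⟨ ≈⇒≡mod (solve 4 (λ x y a b → x :* (y :* y) :* (con (+ 1) :+ :- (con (+ 4) :* a) :+ con (+ 4) :* (a :* a))
                                                                                  := x :* y :* y :+ :- (con (+ 4) :* (x :* y :* y :* a)) :+ con (+ 4) :* (x :* (y :* y) :* (a :* a))) ≈-refl (q^ 2) Y₃ A (W 6 N)) ⟩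
    q^ 2 · Y₃ · Y₃ ⊕ ⊝ (cst (+ 4) · (q^ 2 · Y₃ · Y₃ · A)) ⊕ cst (+ 4) · (q^ 2 · (Y₃ · Y₃) · (A · A))
                                                    ≈⟨ mod-+-congˡ (q^ 2 · Y₃ · Y₃ ⊕ ⊝ (cst (+ 4) · (q^ 2 · Y₃ · Y₃ · A)))
                                                         (mod-cong-modulus (solve 0 (con (+ 4) :* con (+ 2) := con (+ 8)) ≈-refl) (mod-scale (cst (+ 4)) (cst (+ 2)) frobenius)) ⟩
    X₂                                              ∎
    where
    open mod-Reasoning (cst (+ 8))
    Y₃ = W 3 N
    s₉ = recipPhi 9
    A = phiTail 9 N
    Q = 1ₛ ⊕ ⊝ (cst (+ 2) · A) ⊕ cst (+ 4) · (A · A)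
    Q²≡ : Q · Q ≡ 1ₛ ⊕ ⊝ (cst (+ 4) · A) ⊕ cst (+ 4) · (A · A) [mod cst (+ 8) ]
    Q²≡ = A · A ⊕ ⊝ (cst (+ 2) · (A · A · A)) ⊕ cst (+ 2) · (A · A · A · A) ,
      solve 1 (λ a → (con (+ 1) :+ :- (con (+ 2) :* a) :+ con (+ 4) :* (a :* a)) :* (con (+ 1) :+ :- (con (+ 2) :* a) :+ con (+ 4) :* (a :* a))
                     := (con (+ 1) :+ :- (con (+ 4) :* a) :+ con (+ 4) :* (a :* a))
                        :+ con (+ 8) :* (a :* a :+ :- (con (+ 2) :* (a :* a :* a)) :+ con (+ 2) :* (a :* a :* a :* a))) ≈-refl A
    frobenius : q^ 2 · (Y₃ · Y₃) · (A · A) ≡ q^ 2 · W 6 N · phiTail 18 N [mod cst (+ 2) ]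
    frobenius = mod-*-cong (mod-*-congˡ (q^ 2) (W-square 3)) (phiTail-square 9)

  u³v≡X₃ : u · u · u · v ≡ X₃ [mod cst (+ 2) ]
  u³v≡X₃ = begin
    u · u · u · v                                          ≈⟨ ≈⇒≡mod regroup ⟩
    (q^ 1 · q^ 1 · q^ 1 · q^ 2) · (Y₃ · Y₃) · Y₃ · Y₆ · (s₉ · s₉ · s₉ · s₁₈)
                                                           ≈⟨ mod-*-cong (mod-*-congʳ Y₆ (mod-*-congʳ Y₃ (mod-*-cong (≈⇒≡mod q⁵) (W-square 3))))
                                                                         (mod-*-cong (mod-*-cong (mod-*-cong s₉≡1 s₉≡1) s₉≡1) (recipPhi≡1[mod2] 17)) ⟩
    q^ 5 · Y₆ · Y₃ · Y₆ · (1ₛ · 1ₛ · 1ₛ · 1ₛ)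
      ≈⟨ ≈⇒≡mod (solve 3 (λ x y z → x :* z :* y :* z :* (con (+ 1) :* con (+ 1) :* con (+ 1) :* con (+ 1)) := x :* y :* z :* z) ≈-refl (q^ 5) Y₃ Y₆) ⟩
    X₃                                                     ∎
    where
    open mod-Reasoning (cst (+ 2))
    Y₃ = W 3 N
    Y₆ = W 6 N
    s₉ = recipPhi 9
    s₁₈ = recipPhi 18
    s₉≡1 = recipPhi≡1[mod2] 8
    q⁵ : q^ 1 · q^ 1 · q^ 1 · q^ 2 ≈ q^ 5
    q⁵ = ≈-trans (*-congʳ {q^ 2} (≈-trans (*-congʳ {q^ 1} (≗⇒≈ (q^-+ 1 1))) (≗⇒≈ (q^-+ 2 1)))) (≗⇒≈ (q^-+ 3 2))
    module CM = CommutativeMonoidSolver *-commutativeMonoid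
    infixl 7 _⊗_
    _⊗_ : CM.Expr 6 → CM.Expr 6 → CM.Expr 6
    _⊗_ = CM._⊕_
    regroup : u · u · u · v ≈ (q^ 1 · q^ 1 · q^ 1 · q^ 2) · (Y₃ · Y₃) · Y₃ · Y₆ · (s₉ · s₉ · s₉ · s₁₈)
    regroup = CM.prove 6 ((x ⊗ y ⊗ s) ⊗ (x ⊗ y ⊗ s) ⊗ (x ⊗ y ⊗ s) ⊗ (x′ ⊗ z ⊗ t)) ((x ⊗ x ⊗ x ⊗ x′) ⊗ (y ⊗ y) ⊗ y ⊗ z ⊗ (s ⊗ s ⊗ s ⊗ t))
                         (q^ 1 ∷ q^ 2 ∷ Y₃ ∷ Y₆ ∷ s₉ ∷ s₁₈ ∷ [])
      where
      x x′ y z s t : CM.Expr 6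
      x = CM.var (# 0)
      x′ = CM.var (# 1)
      y = CM.var (# 2)
      z = CM.var (# 3)
      s = CM.var (# 4)
      t = CM.var (# 5)

  E : Series
  E = R ⊕ cst (+ 4) · X₂ ⊕ ⊝ (cst (+ 16) · X₃)

  genS9≡E : genS9 N ≡ E [mod cst (+ 32) ]
  genS9≡E = mod-trans genS9≡[mod32]
    (mod-+-cong (mod-+-congˡ R (mod-cong-modulus (solve 0 (con (+ 4) :* con (+ 8) := con (+ 32)) ≈-refl) (mod-scale (cst (+ 4)) (cst (+ 8)) u²≡X₂)))
                (mod-neg-cong (mod-cong-modulus (solve 0 (con (+ 16) :* con (+ 2) := con (+ 32)) ≈-refl) (mod-scale (cst (+ 16)) (cst (+ 2)) u³v≡X₃))))

-- Supports modulo 24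

SupportedIn : List ℕ → Series → Set
SupportedIn L a = ∀ n → n % 24 ∉ L → a n ≡ + 0

infixl 6 _⊞_
_⊞_ : List ℕ → List ℕ → List ℕ
_⊞_ = cartesianProductWith (λ x y → (x + y) % 24)

supported-⊆ : ∀ {L L′ a} → L ⊆ L′ → SupportedIn L a → SupportedIn L′ a
supported-⊆ L⊆L′ supp n n∉L′ = supp n (λ n∈L → n∉L′ (L⊆L′ n∈L))

supported-≗ : ∀ {L a b} → a ≗ b → SupportedIn L b → SupportedIn L a
supported-≗ a≗b supp n n∉L = trans (a≗b n) (supp n n∉L)

supported-⊕ : ∀ {L a b} → SupportedIn L a → SupportedIn L b → SupportedIn L (a ⊕ b)
supported-⊕ suppa suppb n n∉L = cong₂ ℤ._+_ (suppa n n∉L) (suppb n n∉L)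

supported-⊝ : ∀ {L a} → SupportedIn L a → SupportedIn L (⊝ a)
supported-⊝ supp n n∉L = cong ℤ.-_ (supp n n∉L)

supported-cst : ∀ k → SupportedIn (0 ∷ []) (cst k)
supported-cst k zero    0∉ = ⊥-elim (0∉ (here refl))
supported-cst k (suc n) _  = refl

supported-one : ∀ {L} → 0 ∈ L → SupportedIn L one
supported-one 0∈L zero    0∉L = ⊥-elim (0∉L 0∈L)
supported-one 0∈L (suc n) _   = refl

supported-0ₛ : ∀ {L} → SupportedIn L 0ₛ
supported-0ₛ n _ = 0ₛ-coeff n

supported-q^ : ∀ e → SupportedIn (e % 24 ∷ []) (q^ e)
supported-q^ e n n∉ with n ℕ.≡ᵇ e in n≡ᵇe
... | false = refl
... | true  = ⊥-elim (n∉ (here (cong (_% 24) (ℕ.≡ᵇ⇒≡ n e (≡.subst Bool.T (sym n≡ᵇe) _)))))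

·-coeff-vanish : ∀ a b n → (∀ i → i ≤ n → a i ℤ.* b (n ∸ i) ≡ + 0) → (a · b) n ≡ + 0
·-coeff-vanish a b zero    terms = trans (·-coeff-zero a b) (terms 0 z≤n)
·-coeff-vanish a b (suc n) terms = trans (·-coeff-suc a b n)
  (cong₂ ℤ._+_ (terms 0 z≤n) (·-coeff-vanish (tail a) b n (λ i i≤n → terms (suc i) (s≤s i≤n))))

supported-· : ∀ {L L′ a b} → SupportedIn L a → SupportedIn L′ b → SupportedIn (L ⊞ L′) (a · b)
supported-· {L} {L′} {a} {b} suppa suppb n n∉ = ·-coeff-vanish a b n term
  where
  term : ∀ i → i ≤ n → a i ℤ.* b (n ∸ i) ≡ + 0
  term i i≤n with i % 24 ∈? L | (n ∸ i) % 24 ∈? L′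
  ... | no i∉L | _          = cong (ℤ._* b (n ∸ i)) (suppa i i∉L)
  ... | yes _  | no n∸i∉L′  = trans (cong (a i ℤ.*_) (suppb (n ∸ i) n∸i∉L′)) (ℤ.*-zeroʳ (a i))
  ... | yes i∈L | yes n∸i∈L′ = ⊥-elim (n∉ (≡.subst (_∈ L ⊞ L′) residue (∈-cartesianProductWith⁺ (λ x y → (x + y) % 24) i∈L n∸i∈L′)))
    where
    residue : (i % 24 + (n ∸ i) % 24) % 24 ≡ n % 24
    residue = trans (sym (%-distribˡ-+ i (n ∸ i) 24)) (cong (_% 24) (ℕ.m+[n∸m]≡n i≤n))

supported-∑ : ∀ {L} K f → (∀ k → SupportedIn L (f k)) → SupportedIn L (∑ K f)
supported-∑ zero    f supp = supported-0ₛ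
supported-∑ (suc K) f supp = supported-⊕ (supp 0) (supported-∑ K (λ k → f (suc k)) (λ k → supp (suc k)))

supported-prodS : ∀ {L} (f : ℕ → Series) xs → 0 ∈ L → L ⊞ L ⊆ L → (∀ x → SupportedIn L (f x)) → SupportedIn L (prodS (map f xs))
supported-prodS f []       0∈L closed supp = supported-one 0∈L
supported-prodS f (x ∷ xs) 0∈L closed supp = supported-⊆ closed (supported-· (supp x) (supported-prodS f xs 0∈L closed supp))

residue-periodic : ∀ (p h : ℕ → ℕ) → (∀ j → p (j + 24) ≡ p j + h j * 24) → ∀ j → p j % 24 ≡ p (j % 24) % 24
residue-periodic p h shift j = trans (cong (λ k → p k % 24) (m≡m%n+[m/n]*n j 24)) (go (j / 24) (j % 24))
  where
  go : ∀ q r → p (r + q * 24) % 24 ≡ p r % 24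
  go zero    r = cong (λ k → p k % 24) (ℕ.+-identityʳ r)
  go (suc q) r = begin
    p (r + suc q * 24) % 24                         ≡⟨ cong (λ k → p k % 24) (reassoc r q) ⟩
    p (r + q * 24 + 24) % 24                        ≡⟨ cong (_% 24) (shift (r + q * 24)) ⟩
    (p (r + q * 24) + h (r + q * 24) * 24) % 24     ≡⟨ [m+kn]%n≡m%n (p (r + q * 24)) (h (r + q * 24)) 24 ⟩
    p (r + q * 24) % 24                             ≡⟨ go q r ⟩
    p r % 24                                        ∎
    where
    open ≡.≡-Reasoning
    reassoc : ∀ r q → r + suc q * 24 ≡ r + q * 24 + 24
    reassoc = ℕ-Solver.solve-∀

every-residue : ∀ {P : ℕ → Set} → (∀ (r : Fin 24) → P (toℕ r)) → ∀ j → P (j % 24)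
every-residue {P} all j = ≡.subst P (toℕ-fromℕ< (m%n<n j 24)) (all (fromℕ< (m%n<n j 24)))

supported-cst· : ∀ {L a} k → SupportedIn L a → SupportedIn L (cst k · a)
supported-cst· {a = a} k supp n n∉L = trans (cst-· k a n) (trans (cong (k ℤ.*_) (supp n n∉L)) (ℤ.*-zeroʳ k))

periodic-residue : ∀ {P : ℕ → Set} (p h : ℕ → ℕ) → (∀ j → p (j + 24) ≡ p j + h j * 24) →
                   (∀ (r : Fin 24) → P (p (toℕ r) % 24)) → ∀ j → P (p j % 24)
periodic-residue {P} p h shift residues j = ≡.subst P (sym (residue-periodic p h shift j)) (every-residue {λ r → P (p r % 24)} residues j)

supported-q^-∈ : ∀ {L} e → e % 24 ∈ L → SupportedIn L (q^ e)
supported-q^-∈ e e∈L = supported-⊆ (λ { (here refl) → e∈L }) (supported-q^ e)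

supported-1-q^ : ∀ {L} e → 0 ∈ L → e % 24 ∈ L → SupportedIn L (1ₛ ⊕ ⊝ q^ e)
supported-1-q^ e 0∈L e∈L = supported-⊕ (supported-⊆ (λ { (here refl) → 0∈L }) (supported-cst (+ 1)))
                                       (supported-⊝ (supported-q^-∈ e e∈L))

supported-fT : ∀ {L} c N → 0 ∈ L → L ⊞ L ⊆ L → (∀ m → (suc c * suc m) % 24 ∈ L) → SupportedIn L (fT (suc c) N)
supported-fT c N 0∈L closed residues = supported-prodS _ (upTo N) 0∈L closed
  (λ m → supported-≗ (oneMinusQ≗ (m + c * suc m)) (supported-1-q^ (suc c * suc m) 0∈L (residues m)))

supported-geomQ : ∀ {L} c m → (∀ t → (suc c * t) % 24 ∈ L) → SupportedIn L (geomQ (suc c * suc m))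
supported-geomQ {L} c m residues n n∉L = trans (geomQ-indicator (m + c * suc m) n) (indicator (n % M) refl)
  where
  M = suc c * suc m
  indicator : ∀ r → n % M ≡ r → 1ₛ r ≡ + 0
  indicator zero    n%M≡0 = ⊥-elim (n∉L (≡.subst (λ k → k % 24 ∈ L) (sym n≡) (residues (n / M * suc m))))
    where
    regroup : ∀ q c m → 0 + q * (suc c * suc m) ≡ suc c * (q * suc m)
    regroup = ℕ-Solver.solve-∀
    n≡ : n ≡ suc c * (n / M * suc m)
    n≡ = trans (m≡m%n+[m/n]*n n M) (trans (cong (_+ n / M * M) n%M≡0) (regroup (n / M) c m))
  indicator (suc _) _ = refl

supported-fInvT : ∀ {L} c N → 0 ∈ L → L ⊞ L ⊆ L → (∀ t → (suc c * t) % 24 ∈ L) → SupportedIn L (fInvT (suc c) N)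
supported-fInvT c N 0∈L closed residues = supported-prodS _ (upTo N) 0∈L closed (λ m → supported-geomQ c m residues)

multiplesOf3 multiplesOf6 ≡1[mod3] ≡2[mod3] ≡2[mod6] : List ℕ
multiplesOf3 = 0 ∷ 3 ∷ 6 ∷ 9 ∷ 12 ∷ 15 ∷ 18 ∷ 21 ∷ []
multiplesOf6 = 0 ∷ 6 ∷ 12 ∷ 18 ∷ []
≡1[mod3] = 1 ∷ 4 ∷ 7 ∷ 10 ∷ 13 ∷ 16 ∷ 19 ∷ 22 ∷ []
≡2[mod3] = 2 ∷ 5 ∷ 8 ∷ 11 ∷ 14 ∷ 17 ∷ 20 ∷ 23 ∷ []
≡2[mod6] = 2 ∷ 8 ∷ 14 ∷ 20 ∷ []

avoiding11,23 avoiding23 : List ℕ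
avoiding11,23 = 0 ∷ 1 ∷ 2 ∷ 3 ∷ 4 ∷ 5 ∷ 6 ∷ 7 ∷ 8 ∷ 9 ∷ 10 ∷ 12 ∷ 13 ∷ 14 ∷ 15 ∷ 16 ∷ 17 ∷ 18 ∷ 19 ∷ 20 ∷ 21 ∷ 22 ∷ []
avoiding23 = 0 ∷ 1 ∷ 2 ∷ 3 ∷ 4 ∷ 5 ∷ 6 ∷ 7 ∷ 8 ∷ 9 ∷ 10 ∷ 11 ∷ 12 ∷ 13 ∷ 14 ∷ 15 ∷ 16 ∷ 17 ∷ 18 ∷ 19 ∷ 20 ∷ 21 ∷ 22 ∷ []

by-residues : ∀ {P : ℕ → Set} (P? : Decidable P) (p h : ℕ → ℕ) → (∀ j → p (j + 24) ≡ p j + h j * 24) →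
              {_ : True (all? (λ (r : Fin 24) → P? (p (toℕ r) % 24)))} → ∀ j → P (p j % 24)
by-residues {P} P? p h shift {residues} = periodic-residue {P} p h shift (toWitness residues)

residues-in : ∀ L (p h : ℕ → ℕ) → (∀ j → p (j + 24) ≡ p j + h j * 24) →
              {_ : True (all? (λ (r : Fin 24) → p (toℕ r) % 24 ∈? L))} → ∀ j → p j % 24 ∈ L
residues-in L = by-residues (_∈? L)

residues-∉ : ∀ L (p h : ℕ → ℕ) → (∀ j → p (j + 24) ≡ p j + h j * 24) →
             {_ : True (all? (λ (r : Fin 24) → p (toℕ r) % 24 ∉? L))} → ∀ j → p j % 24 ∉ L
residues-∉ L = by-residues (_∉? L)

q^-residues : ∀ L (p h : ℕ → ℕ) → (∀ j → p (j + 24) ≡ p j + h j * 24) →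
              {_ : True (all? (λ (r : Fin 24) → p (toℕ r) % 24 ∈? L))} → ∀ j → SupportedIn L (q^ (p j))
q^-residues L p h shift {residues} j = supported-q^-∈ (p j) (residues-in L p h shift {residues} j)

⊆-decide : ∀ L L′ → {_ : True (L ⊆? L′)} → L ⊆ L′
⊆-decide L L′ {L⊆L′} = toWitness L⊆L′

supported-sgn· : ∀ {L a} j → SupportedIn L a → SupportedIn L (sgn j · a)
supported-sgn· j = supported-cst· (ℤ.-1ℤ ℤ.^ j)

supported-W3 : ∀ N → SupportedIn (0 ∷ 3 ∷ 15 ∷ []) (W 3 N)
supported-W3 N = supported-∑ (suc N) (wTerm 3) (λ j →
  supported-⊕ (supported-sgn· j (q^-residues _ (λ j → 3 * (3 * j * j + 2 * j)) (λ j → 18 * j + 222) ℕ-Solver.solve-∀ j))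
              (supported-⊝ (supported-sgn· j (q^-residues _ (λ j → 3 * (3 * j * j + 4 * j + 1)) (λ j → 18 * j + 228) ℕ-Solver.solve-∀ j))))

supported-W6 : ∀ N → SupportedIn (0 ∷ 6 ∷ []) (W 6 N)
supported-W6 N = supported-∑ (suc N) (wTerm 6) (λ j →
  supported-⊕ (supported-sgn· j (q^-residues _ (λ j → 6 * (3 * j * j + 2 * j)) (λ j → 36 * j + 444) ℕ-Solver.solve-∀ j))
              (supported-⊝ (supported-sgn· j (q^-residues _ (λ j → 6 * (3 * j * j + 4 * j + 1)) (λ j → 36 * j + 456) ℕ-Solver.solve-∀ j))))

supported-phiTail9 : ∀ N → SupportedIn (0 ∷ 9 ∷ 12 ∷ []) (phiTail 9 N)
supported-phiTail9 N = supported-∑ (suc N) (phiTerm 9) (λ k →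
  supported-sgn· (suc k) (q^-residues _ (λ k → 9 * (suc k * suc k)) (λ k → 18 * k + 234) ℕ-Solver.solve-∀ k))

supported-phiTail18 : ∀ N → SupportedIn (0 ∷ 18 ∷ []) (phiTail 18 N)
supported-phiTail18 N = supported-∑ (suc N) (phiTerm 18) (λ k →
  supported-sgn· (suc k) (q^-residues _ (λ k → 18 * (suc k * suc k)) (λ k → 36 * k + 468) ℕ-Solver.solve-∀ k))

supported-recipPhi9 : ∀ N → SupportedIn multiplesOf3 (GeneratingFunction.recipPhi N 9)
supported-recipPhi9 N = supported-⊆ closed (supported-· (supported-⊆ closed (supported-· f₁₈ f⁻¹₉)) f⁻¹₉)
  where
  closed = ⊆-decide (multiplesOf3 ⊞ multiplesOf3) multiplesOf3
  f₁₈ = supported-fT 17 N (here refl) closed (residues-in _ (λ m → 18 * suc m) (λ _ → 18) ℕ-Solver.solve-∀)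
  f⁻¹₉ = supported-fInvT 8 N (here refl) closed (residues-in _ (λ t → 9 * t) (λ _ → 9) ℕ-Solver.solve-∀)

supported-recipPhi18 : ∀ N → SupportedIn multiplesOf6 (GeneratingFunction.recipPhi N 18)
supported-recipPhi18 N = supported-⊆ closed (supported-· (supported-⊆ closed (supported-· f₃₆ f⁻¹₁₈)) f⁻¹₁₈)
  where
  closed = ⊆-decide (multiplesOf6 ⊞ multiplesOf6) multiplesOf6
  f₃₆ = supported-fT 35 N (here refl) closed (residues-in _ (λ m → 36 * suc m) (λ _ → 36) ℕ-Solver.solve-∀)
  f⁻¹₁₈ = supported-fInvT 17 N (here refl) closed (residues-in _ (λ t → 18 * t) (λ _ → 18) ℕ-Solver.solve-∀)

module Supports (N : ℕ) where
  open GeneratingFunction N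
  open Congruences N

  supported-u : SupportedIn ≡1[mod3] u
  supported-u = supported-⊆ (⊆-decide _ _) (supported-· (supported-· (supported-q^ 1) (supported-W3 N)) (supported-recipPhi9 N))

  supported-v : SupportedIn ≡2[mod6] v
  supported-v = supported-⊆ (⊆-decide _ _) (supported-· (supported-· (supported-q^ 2) (supported-W6 N)) (supported-recipPhi18 N))

  supported-u² : SupportedIn ≡2[mod3] (u · u)
  supported-u² = supported-⊆ (⊆-decide _ _) (supported-· supported-u supported-u)

  supported-u³ : SupportedIn multiplesOf3 (u · u · u)
  supported-u³ = supported-⊆ (⊆-decide _ _) (supported-· supported-u² supported-u)

  supported-R : SupportedIn avoiding11,23 R
  supported-R = supported-⊕ (supported-⊕ (supported-⊕ (supported-⊕ (supported-⊕ (supported-⊕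
    (widen (supported-cst (+ 1)))
    (widen (supported-cst· (+ 2) supported-u)))
    (widen (supported-cst· (+ 8) supported-u³)))
    (widen (supported-cst· (+ 16) (supported-· supported-u³ supported-u))))
    (supported-⊝ (widen (supported-cst· (+ 2) supported-v))))
    (supported-⊝ (widen (supported-cst· (+ 4) (supported-· supported-u supported-v)))))
    (supported-⊝ (widen (supported-cst· (+ 8) (supported-· supported-u² supported-v))))
    where
    widen : ∀ {L a} {_ : True (L ⊆? avoiding11,23)} → SupportedIn L a → SupportedIn avoiding11,23 a
    widen {L} {_} {L⊆} = supported-⊆ (toWitness L⊆)

  supported-q²W3²′ : SupportedIn (2 ∷ 5 ∷ 8 ∷ 17 ∷ 20 ∷ []) (q^ 2 · W 3 N · W 3 N)
  supported-q²W3²′ = supported-⊆ (⊆-decide _ _) (supported-· (supported-· (supported-q^ 2) (supported-W3 N)) (supported-W3 N))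

  supported-q²W3² : SupportedIn avoiding11,23 (q^ 2 · W 3 N · W 3 N)
  supported-q²W3² = supported-⊆ (⊆-decide _ _) supported-q²W3²′

  supported-q²W3²A9 : SupportedIn avoiding23 (q^ 2 · W 3 N · W 3 N · phiTail 9 N)
  supported-q²W3²A9 = supported-⊆ (⊆-decide _ _) (supported-· supported-q²W3²′ (supported-phiTail9 N))

  supported-q²W6A18 : SupportedIn avoiding23 (q^ 2 · W 6 N · phiTail 18 N)
  supported-q²W6A18 = supported-⊆ (⊆-decide _ _) (supported-· (supported-· (supported-q^ 2) (supported-W6 N)) (supported-phiTail18 N))

  supported-X₃ : SupportedIn avoiding23 X₃
  supported-X₃ = supported-⊆ (⊆-decide _ _) (supported-· (supported-⊆ (⊆-decide _ (2 ∷ 5 ∷ 8 ∷ 11 ∷ 14 ∷ 20 ∷ [])) q⁵W3W6) (supported-W6 N))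
    where q⁵W3W6 = supported-· (supported-· (supported-q^ 5) (supported-W3 N)) (supported-W6 N)

module Coefficients (N : ℕ) where
  open Truncated N using (coeff≡; quotient; x≈y+mq)
  open GeneratingFunction N
  open Congruences N
  open Supports N

  a b c : ℤ
  a = (q^ 2 · W 3 N · W 3 N) N
  b = (q^ 2 · W 3 N · W 3 N · phiTail 9 N) N
  c = (q^ 2 · W 6 N · phiTail 18 N) N

  q : Series
  q = quotient genS9≡E

  S9bar≡ : S9bar N ≡ (R N ℤ.+ + 4 ℤ.* ((a ℤ.+ ℤ.- (+ 4 ℤ.* b)) ℤ.+ + 4 ℤ.* c)) ℤ.+ ℤ.- (+ 16 ℤ.* X₃ N) ℤ.+ + 32 ℤ.* q N
  S9bar≡ = begin
    genS9 N N                                                              ≡⟨ coeff≡ (x≈y+mq genS9≡E) N ℕ.≤-refl ⟩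
    (R N ℤ.+ (cst (+ 4) · X₂) N) ℤ.+ ℤ.- (cst (+ 16) · X₃) N ℤ.+ (cst (+ 32) · q) N
                                                                           ≡⟨ cong₂ ℤ._+_ (cong₂ ℤ._+_ (cong (ℤ._+_ (R N)) (cst-· (+ 4) X₂ N)) (cong ℤ.-_ (cst-· (+ 16) X₃ N))) (cst-· (+ 32) q N) ⟩
    (R N ℤ.+ + 4 ℤ.* X₂ N) ℤ.+ ℤ.- (+ 16 ℤ.* X₃ N) ℤ.+ + 32 ℤ.* q N         ≡⟨ cong (λ x → (R N ℤ.+ + 4 ℤ.* x) ℤ.+ ℤ.- (+ 16 ℤ.* X₃ N) ℤ.+ + 32 ℤ.* q N) X₂≡ ⟩
    (R N ℤ.+ + 4 ℤ.* ((a ℤ.+ ℤ.- (+ 4 ℤ.* b)) ℤ.+ + 4 ℤ.* c)) ℤ.+ ℤ.- (+ 16 ℤ.* X₃ N) ℤ.+ + 32 ℤ.* q N ∎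
    where
    open ≡.≡-Reasoning
    X₂≡ : X₂ N ≡ (a ℤ.+ ℤ.- (+ 4 ℤ.* b)) ℤ.+ + 4 ℤ.* c
    X₂≡ = cong₂ ℤ._+_ (cong (λ x → a ℤ.+ ℤ.- x) (cst-· (+ 4) (q^ 2 · W 3 N · W 3 N · phiTail 9 N) N)) (cst-· (+ 4) (q^ 2 · W 6 N · phiTail 18 N) N)

  S9bar-16-multiple : N % 24 ∉ avoiding11,23 → S9bar N ≡ + 16 ℤ.* ((ℤ.- b ℤ.+ c) ℤ.+ ℤ.- X₃ N ℤ.+ + 2 ℤ.* q N)
  S9bar-16-multiple N∉ = trans S9bar≡ (trans (cong₂ (λ r a → (r ℤ.+ + 4 ℤ.* ((a ℤ.+ ℤ.- (+ 4 ℤ.* b)) ℤ.+ + 4 ℤ.* c)) ℤ.+ ℤ.- (+ 16 ℤ.* X₃ N) ℤ.+ + 32 ℤ.* q N)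
                                           (supported-R N N∉) (supported-q²W3² N N∉))
                                    (collect b c (X₃ N) (q N)))
    where
    collect : ∀ b c x k → (+ 0 ℤ.+ + 4 ℤ.* ((+ 0 ℤ.+ ℤ.- (+ 4 ℤ.* b)) ℤ.+ + 4 ℤ.* c)) ℤ.+ ℤ.- (+ 16 ℤ.* x) ℤ.+ + 32 ℤ.* k
                        ≡ + 16 ℤ.* ((ℤ.- b ℤ.+ c) ℤ.+ ℤ.- x ℤ.+ + 2 ℤ.* k)
    collect = solve-∀

  S9bar-32-multiple : N % 24 ∉ avoiding11,23 → N % 24 ∉ avoiding23 → S9bar N ≡ + 32 ℤ.* q N
  S9bar-32-multiple N∉ N∉′ = trans (S9bar-16-multiple N∉) (trans (cong₂ (λ b c → + 16 ℤ.* ((ℤ.- b ℤ.+ c) ℤ.+ ℤ.- X₃ N ℤ.+ + 2 ℤ.* q N))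
                                                      (supported-q²W3²A9 N N∉′) (supported-q²W6A18 N N∉′))
                                               (trans (cong (λ x → + 16 ℤ.* ((ℤ.- + 0 ℤ.+ + 0) ℤ.+ ℤ.- x ℤ.+ + 2 ℤ.* q N)) (supported-X₃ N N∉′))
                                                      (collect (q N))))
    where
    collect : ∀ k → + 16 ℤ.* ((ℤ.- + 0 ℤ.+ + 0) ℤ.+ ℤ.- + 0 ℤ.+ + 2 ℤ.* k) ≡ + 32 ℤ.* k
    collect = solve-∀

∣-by : ∀ m {i} k → i ≡ m ℤ.* k → m ∣ i
∣-by m k i≡ = ∣⇒∣ᵤ (Signed.divides k (trans i≡ (ℤ.*-comm m k)))

mainTheorem15 : (n : ℕ) →
    ((+ 16) ∣ S9bar (12 * n + 11)) × ((+ 32) ∣ S9bar (24 * n + 23))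
mainTheorem15 n =
    ∣-by (+ 16) _ (Coefficients.S9bar-16-multiple (12 * n + 11) (residues-∉ avoiding11,23 (λ n → 12 * n + 11) (λ _ → 12) ℕ-Solver.solve-∀ n))
  , ∣-by (+ 32) _ (Coefficients.S9bar-32-multiple (24 * n + 23) (residues-∉ avoiding11,23 (λ n → 24 * n + 23) (λ _ → 24) ℕ-Solver.solve-∀ n)
                                                       (residues-∉ avoiding23 (λ n → 24 * n + 23) (λ _ → 24) ℕ-Solver.solve-∀ n))
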